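{- For all $k\ge1$, $$F^-_{[k]\ominus231}(x)=F^-_{[k]\ominus12}(x)=\frac{(1+x^2)W_{k-1}(x)-ix(1+x)W_{k-2}(x)}{ix\big((1+x^2)W_k(x)-ix(1+x)W_{k-1}(x)\big)}.$$
   Context: $[k]=k(k-1)\cdots21$. For $\pi\in S_m$ and $\sigma\in S_n$, the skew sum $\pi\ominus\sigma$ has entries $\pi(i)+n$ for $i\le m$ and $\sigma(i-m)$ for $i>m$. For a permutation $\sigma$, $F^-_\sigma(x)=\sum_\tau\operatorname{sign}(\tau)x^{|\tau|}$, summed over involutions $\tau$ of any length avoiding both $3412$ and $\sigma$. Here $\operatorname{sign}(\tau)=\pm1$ is the sign of $\tau$. $U_n$ is the Chebyshev polynomial of the second kind, with $U_n(\cos t)=\sin((n+1)t)/\sin t$ for $n\ge0$ and $U_n=0$ for $n<0$. We set $W_n(x)=U_n\!\left(\frac{1-x}{2ix}\right)$. -}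

module Defs where

open import Data.Nat.Base using (ℕ; zero; suc; _+_; _∸_; _<ᵇ_; _≡ᵇ_)
open import Data.Integer.Base as ℤ using (ℤ; 0ℤ; 1ℤ; -_)
open import Data.Bool.Base using (Bool; true; false; _∧_; not; _xor_; if_then_else_)
open import Relation.Binary.PropositionalEquality using (_≡_)
open import Data.Bool.ListAction using (all; any)
open import Data.List.Base using (List; []; _∷_; _++_; map; concatMap; length; foldr; upTo; reverse)

-- Permutations in one-line notation: a permutation of length n is the
-- list (π(1), …, π(n)) of the values 1 … n.

insertEverywhere : ℕ → List ℕ → List (List ℕ)
insertEverywhere x []       = (x ∷ []) ∷ []
insertEverywhere x (y ∷ ys) = (x ∷ y ∷ ys) ∷ map (y ∷_) (insertEverywhere x ys)

perms : ℕ → List (List ℕ)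
perms zero    = [] ∷ []
perms (suc n) = concatMap (insertEverywhere (suc n)) (perms n)

-- π(i) for 1-indexed position i (0 outside the range)
at : List ℕ → ℕ → ℕ
at []       _             = 0
at (x ∷ xs) zero          = 0
at (x ∷ xs) (suc zero)    = x
at (x ∷ xs) (suc (suc i)) = at xs (suc i)

positions : ℕ → List ℕ
positions n = map suc (upTo n)

isInvolution : List ℕ → Bool
isInvolution τ = all (λ i → at τ (at τ i) ≡ᵇ i) (positions (length τ))

inversions : List ℕ → ℕ
inversions []       = 0
inversions (x ∷ xs) = foldr _+_ 0 (map (λ y → if y <ᵇ x then 1 else 0) xs) + inversions xs

sgn : ℕ → ℤ
sgn zero    = 1ℤ
sgn (suc n) = - sgn n

sign : List ℕ → ℤ
sign τ = sgn (inversions τ)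

subseqs : {A : Set} → ℕ → List A → List (List A)
subseqs zero    _        = [] ∷ []
subseqs (suc m) []       = []
subseqs (suc m) (x ∷ xs) = map (x ∷_) (subseqs m xs) ++ subseqs (suc m) xs

sameOrder : List ℕ → List ℕ → Bool
sameOrder []       []       = true
sameOrder (x ∷ xs) (y ∷ ys) = pairwise xs ys ∧ sameOrder xs ys
  where
  pairwise : List ℕ → List ℕ → Bool
  pairwise []        []        = true
  pairwise (x' ∷ xs') (y' ∷ ys') =
    not ((x <ᵇ x') xor (y <ᵇ y')) ∧ pairwise xs' ys'
  pairwise _ _ = false
sameOrder _ _ = false

contains : List ℕ → List ℕ → Bool
contains σ τ = any (λ s → sameOrder s σ) (subseqs (length σ) τ)

avoids : List ℕ → List ℕ → Bool
avoids σ τ = not (contains σ τ)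

-- [k] = k (k-1) … 2 1
decr : ℕ → List ℕ
decr k = reverse (positions k)

_⊖_ : List ℕ → List ℕ → List ℕ
π ⊖ σ = map (_+ length σ) π ++ σ

p3412 p231 p12 : List ℕ
p3412 = 3 ∷ 4 ∷ 1 ∷ 2 ∷ []
p231  = 2 ∷ 3 ∷ 1 ∷ []
p12   = 1 ∷ 2 ∷ []

Series : Set
Series = ℕ → ℤ

sumℤ : List ℤ → ℤ
sumℤ = foldr ℤ._+_ 0ℤ

infixl 6 _⊕_
infixl 7 _⊛_
infix 4 _≗ₛ_

_⊕_ : Series → Series → Series
(a ⊕ b) n = a n ℤ.+ b n

_⊛_ : Series → Series → Series
(a ⊛ b) n = sumℤ (map (λ j → a j ℤ.* b (n ∸ j)) (upTo (suc n)))

_≗ₛ_ : Series → Series → Set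
a ≗ₛ b = ∀ n → a n ≡ b n

cst : ℤ → Series
cst c zero    = c
cst c (suc _) = 0ℤ

xpow : ℕ → Series
xpow m n = if m ≡ᵇ n then 1ℤ else 0ℤ

F⁻ : List ℕ → Series
F⁻ σ n = sumℤ (map (λ τ → if isInvolution τ ∧ avoids p3412 τ ∧ avoids σ τ
                             then sign τ else 0ℤ)
                   (perms n))

-- With W_n(x) = U_n((1-x)/(2ix)) we set
--   Q (n+1) = (ix)^n W_n(x)   (n ≥ -1, so Q 0 = 0 corresponds to U_{-1} = 0).
-- From U_{n+1}(y) = 2y U_n(y) - U_{n-1}(y), U_{-1}=0, U_0=1, one gets
--   Q 0 = 0, Q 1 = 1, Q (n+2) = (1-x) Q (n+1) + x² Q n,
-- a polynomial with integer coefficients.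
Q : ℕ → Series
Q zero          = cst 0ℤ
Q (suc zero)    = cst 1ℤ
Q (suc (suc n)) = ((cst 1ℤ ⊕ cst (- 1ℤ) ⊛ xpow 1) ⊛ Q (suc n)) ⊕ (xpow 2 ⊛ Q n)

-- Multiplying numerator and denominator of
--   ((1+x²)W_{k-1} - ix(1+x)W_{k-2}) / (ix((1+x²)W_k - ix(1+x)W_{k-1}))
-- by (ix)^{k-1} gives Num k / Den k with:
Num : ℕ → Series
Num k = ((cst 1ℤ ⊕ xpow 2) ⊛ Q k) ⊕ ((xpow 2 ⊛ (cst 1ℤ ⊕ xpow 1)) ⊛ Q (k ∸ 1))

Den : ℕ → Series
Den k = ((cst 1ℤ ⊕ xpow 2) ⊛ Q (suc k)) ⊕ ((xpow 2 ⊛ (cst 1ℤ ⊕ xpow 1)) ⊛ Q k)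

{-# OPTIONS --safe #-}
-- A 3412-avoiding involution τ of length n + 1 either fixes 1, and then τ = 1 ⊞ ρ, or
-- exchanges 1 and some m ≥ 2.  In the second case avoiding 3412 forces the entries strictly
-- between positions 1 and m to be exactly 2, …, m - 1, so τ = arc σ ⊞ ρ with
-- arc σ = (m, σ + 1, 1), where σ and ρ are again 3412-avoiding involutions and
-- sign τ = - sign σ · sign ρ.  For π = [k + 1] ⊖ 12 the involution 1 ⊞ ρ contains π iff ρ does,
-- and arc σ ⊞ ρ contains π iff σ contains [k] ⊖ 12 or ρ contains π; the same holds for
-- π = [k + 1] ⊖ 231.  Hence both signed generating functions satisfy
-- F = 1 + x F - x² P_k F, i.e. F · (1 - x + x² P_k) = 1 with P_k = F⁻_{[k]⊖12}, and therefore
-- agree, while P_0 (1 + x²) = 1 + x.  The numerators Num k obey the Chebyshev recurrence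
-- N_{k+2} = (1 - x) N_{k+1} + x² N_k, which turns P_k = N_k / N_{k+1} into the same
-- continued-fraction recursion.

module Submission where

open import Defs
open import Level using (0ℓ)
open import Algebra.Bundles using (CommutativeMonoid; CommutativeSemiring)
open import Algebra.Structures.Biased using (isCommutativeSemiringˡ; isCommutativeMonoidˡ)
import Algebra.Construct.Pointwise as Pointwise
import Algebra.Solver.Ring.NaturalCoefficients.Default as NaturalCoefficientsSolver
open import Data.Nat.Base using (ℕ; zero; suc; _+_; _∸_; _≤_; _<_; z≤n; s≤s; _<ᵇ_)
import Data.Nat.Properties as ℕ
open import Data.Nat.Solver using () renaming (module +-*-Solver to ℕ-Solver)
open import Data.Integer.Base using (ℤ; 0ℤ; 1ℤ; -_) renaming (_+_ to _+ℤ_; _*_ to _*ℤ_)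
import Data.Integer.Properties as ℤ
open import Data.Integer.Solver using () renaming (module +-*-Solver to ℤ-Solver)
open import Algebra.Properties.CommutativeSemigroup ℤ.+-commutativeSemigroup using (interchange)
open import Data.Bool.Base using (Bool; true; false; _∧_; not; _xor_; T; if_then_else_)
open import Data.Bool.Properties using (T?; T-∧; ∧-assoc; ∧-identityʳ; ∧-zeroʳ)
open import Data.Maybe.Base using (just; fromMaybe)
open import Data.Product.Base using (_×_; _,_; proj₁; proj₂; ∃; ∃₂; ∃-syntax)
open import Data.Sum.Base using (_⊎_; inj₁; inj₂; [_,_]′; map₁; map₂)
open import Data.Empty using (⊥; ⊥-elim)
open import Data.List.Base
  using (List; []; _∷_; _++_; [_]; map; foldr; length; null; head; reverse; upTo; concatMap; cartesianProductWith; filter; filterᵇ)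
open import Data.List.Properties
  using ( length-++; length-map; length-upTo; map-++; map-∘; map-cong; map-cong-local; map-applyUpTo; upTo-∷ʳ
        ; ++-assoc; ++-identityʳ; reverse-++; ∷-injective; ∷-injectiveˡ; ∷-injectiveʳ; ∷ʳ-injective; ∷ʳ-injectiveˡ
        ; filter-++; filter-all; filter-reject )
open import Data.List.Membership.Propositional using (_∈_; _∉_; find; lose)
open import Data.List.Membership.Propositional.Properties
  using ( ∈-map⁺; ∈-map⁻; ∈-++⁺ˡ; ∈-++⁺ʳ; ∈-++⁻; ∈-∃++; ∈-upTo⁺; ∈-upTo⁻; ∈-concat⁺′; ∈-concat⁻′
        ; ∈-filter⁺; ∈-filter⁻; ∈-cartesianProductWith⁺; ∈-cartesianProductWith⁻ )
open import Data.List.Membership.Propositional.Properties.WithK using (unique∧set⇒bag)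
open import Data.List.Relation.Unary.Any using (here; there)
open import Data.List.Relation.Unary.Any.Properties using (any⁺; any⁻)
open import Data.List.Relation.Unary.All as All using (All; []; _∷_)
import Data.List.Relation.Unary.All.Properties as All
open import Data.List.Relation.Unary.AllPairs using ([]; _∷_)
open import Data.List.Relation.Unary.Unique.Propositional using (Unique)
import Data.List.Relation.Unary.Unique.Propositional.Properties as Unique
open import Data.List.Relation.Binary.Sublist.Propositional using (_⊆_; []; _∷_; _∷ʳ_; ⊆-refl; ⊆-trans; minimum; from∈)
open import Data.List.Relation.Binary.Sublist.Propositional.Properties using (All-resp-⊆) renaming (map⁺ to ⊆-map⁺)
import Data.List.Relation.Binary.Sublist.Heterogeneous.Properties as Sublist
open import Data.List.Relation.Binary.Permutation.Propositional using (_↭_; prep; ↭-refl; ↭-sym; ↭-trans; ↭-reflexive; ↭⇒↭ₛ)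
open import Data.List.Relation.Binary.Permutation.Propositional.Properties
  using (∈-resp-↭; ↭-length; drop-mid; ∷↭∷ʳ; shift) renaming (map⁺ to ↭-map⁺)
open import Data.List.Relation.Binary.Permutation.Setoid.Properties using (foldr-commMonoid)
open import Data.List.Relation.Binary.BagAndSetEquality using (∼bag⇒↭)
open import Function.Base using (id; _∘_; _∘′_)
open import Function.Bundles using (_⇔_; mk⇔; Equivalence)
open import Relation.Nullary using (¬_; yes; no)
open import Relation.Nullary.Reflects using (Reflects; ofʸ; ofⁿ; fromEquivalence; ¬-reflects; _×-reflects_; det)
open import Relation.Binary.Definitions using (tri<; tri≈; tri>)
import Relation.Binary.Reasoning.Setoid as SetoidReasoning
open import Relation.Binary.PropositionalEquality
  using (_≡_; _≢_; refl; sym; trans; cong; cong₂; subst; isEquivalence; module ≡-Reasoning)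

-- Finite sums

sumℤ-map-+ : ∀ {A : Set} (f g : A → ℤ) xs →
             sumℤ (map (λ x → f x +ℤ g x) xs) ≡ sumℤ (map f xs) +ℤ sumℤ (map g xs)
sumℤ-map-+ f g []       = refl
sumℤ-map-+ f g (x ∷ xs) =
  trans (cong ((f x +ℤ g x) +ℤ_) (sumℤ-map-+ f g xs)) (interchange (f x) (g x) _ _)

sumℤ-map-*ˡ : ∀ {A : Set} c (f : A → ℤ) xs → sumℤ (map (λ x → c *ℤ f x) xs) ≡ c *ℤ sumℤ (map f xs)
sumℤ-map-*ˡ c f []       = sym (ℤ.*-zeroʳ c)
sumℤ-map-*ˡ c f (x ∷ xs) =
  trans (cong (c *ℤ f x +ℤ_) (sumℤ-map-*ˡ c f xs)) (sym (ℤ.*-distribˡ-+ c (f x) _))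

sumℤ-map-0 : ∀ {A : Set} (xs : List A) → sumℤ (map (λ _ → 0ℤ) xs) ≡ 0ℤ
sumℤ-map-0 []       = refl
sumℤ-map-0 (x ∷ xs) = trans (ℤ.+-identityˡ _) (sumℤ-map-0 xs)

sumℤ-↭ : ∀ {xs ys} → xs ↭ ys → sumℤ xs ≡ sumℤ ys
sumℤ-↭ p = foldr-commMonoid ℤ+0.setoid ℤ+0.isCommutativeMonoid (↭⇒↭ₛ p)
  where module ℤ+0 = CommutativeMonoid ℤ.+-0-commutativeMonoid

sumℤ-++ : ∀ xs ys → sumℤ (xs ++ ys) ≡ sumℤ xs +ℤ sumℤ ys
sumℤ-++ []       ys = sym (ℤ.+-identityˡ _)
sumℤ-++ (x ∷ xs) ys = trans (cong (x +ℤ_) (sumℤ-++ xs ys)) (sym (ℤ.+-assoc x _ _))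

sumℤ-map-neg : ∀ {A : Set} (f : A → ℤ) xs → sumℤ (map (λ x → - f x) xs) ≡ - sumℤ (map f xs)
sumℤ-map-neg f []       = refl
sumℤ-map-neg f (x ∷ xs) = trans (cong (- f x +ℤ_) (sumℤ-map-neg f xs)) (sym (ℤ.neg-distrib-+ (f x) _))

sumℤ-map-*ʳ : ∀ {A : Set} c (f : A → ℤ) xs → sumℤ (map (λ x → f x *ℤ c) xs) ≡ sumℤ (map f xs) *ℤ c
sumℤ-map-*ʳ c f []       = sym (ℤ.*-zeroˡ c)
sumℤ-map-*ʳ c f (x ∷ xs) = trans (cong (f x *ℤ c +ℤ_) (sumℤ-map-*ʳ c f xs)) (sym (ℤ.*-distribʳ-+ c (f x) _))

sumℤ-concatMap : ∀ {A B : Set} (f : B → ℤ) (g : A → List B) xs →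
                 sumℤ (map f (concatMap g xs)) ≡ sumℤ (map (λ x → sumℤ (map f (g x))) xs)
sumℤ-concatMap f g []       = refl
sumℤ-concatMap f g (x ∷ xs) = trans (cong sumℤ (map-++ f (g x) (concatMap g xs)))
  (trans (sumℤ-++ (map f (g x)) _) (cong (sumℤ (map f (g x)) +ℤ_) (sumℤ-concatMap f g xs)))

sumℤ-cartesianProductWith : ∀ {A B C : Set} (f : C → ℤ) (h : A → B → C) xs ys →
  sumℤ (map f (cartesianProductWith h xs ys)) ≡ sumℤ (map (λ x → sumℤ (map (λ y → f (h x y)) ys)) xs)
sumℤ-cartesianProductWith f h []       ys = refl
sumℤ-cartesianProductWith f h (x ∷ xs) ys = trans (cong sumℤ (map-++ f (map (h x) ys) _))
  (trans (sumℤ-++ (map f (map (h x) ys)) _)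
         (cong₂ _+ℤ_ (cong sumℤ (sym (map-∘ ys))) (sumℤ-cartesianProductWith f h xs ys)))

sumℤ-filterᵇ : ∀ {A : Set} (p c : A → Bool) (s : A → ℤ) xs →
  sumℤ (map (λ x → if p x ∧ c x then s x else 0ℤ) xs) ≡ sumℤ (map (λ x → if c x then s x else 0ℤ) (filterᵇ p xs))
sumℤ-filterᵇ p c s []       = refl
sumℤ-filterᵇ p c s (x ∷ xs) with p x
... | true  = cong ((if c x then s x else 0ℤ) +ℤ_) (sumℤ-filterᵇ p c s xs)
... | false = trans (ℤ.+-identityˡ _) (sumℤ-filterᵇ p c s xs)

-- Formal power series

tail : Series → Series
tail a n = a (suc n)

⊛-0 : ∀ a b → (a ⊛ b) 0 ≡ a 0 *ℤ b 0
⊛-0 a b = ℤ.+-identityʳ _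

⊛-suc : ∀ a b n → (a ⊛ b) (suc n) ≡ a 0 *ℤ b (suc n) +ℤ (tail a ⊛ b) n
⊛-suc a b n = cong (λ l → a 0 *ℤ b (suc n) +ℤ sumℤ l)
  (trans (map-applyUpTo suc (λ j → a j *ℤ b (suc n ∸ j)) (suc n))
         (sym (map-applyUpTo id (λ j → a (suc j) *ℤ b (n ∸ j)) (suc n))))

⊛-cong : ∀ {a a′ b b′} → a ≗ₛ a′ → b ≗ₛ b′ → a ⊛ b ≗ₛ a′ ⊛ b′
⊛-cong a≗a′ b≗b′ n = cong sumℤ (map-cong (λ j → cong₂ _*ℤ_ (a≗a′ j) (b≗b′ (n ∸ j))) (upTo (suc n)))

⊛-distribʳ : ∀ c a b → (a ⊕ b) ⊛ c ≗ₛ a ⊛ c ⊕ b ⊛ c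
⊛-distribʳ c a b n =
  trans (cong sumℤ (map-cong (λ j → ℤ.*-distribʳ-+ (c (n ∸ j)) (a j) (b j)) (upTo (suc n))))
        (sumℤ-map-+ (λ j → a j *ℤ c (n ∸ j)) (λ j → b j *ℤ c (n ∸ j)) (upTo (suc n)))

cst-⊛ : ∀ c a n → (cst c ⊛ a) n ≡ c *ℤ a n
cst-⊛ c a zero    = ⊛-0 (cst c) a
cst-⊛ c a (suc n) = begin
  (cst c ⊛ a) (suc n)                     ≡⟨ ⊛-suc (cst c) a n ⟩
  c *ℤ a (suc n) +ℤ (tail (cst c) ⊛ a) n                ≡⟨ cong (c *ℤ a (suc n) +ℤ_) (cong sumℤ
                                                             (map-cong (λ j → ℤ.*-zeroˡ (a (n ∸ j))) (upTo (suc n)))) ⟩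
  c *ℤ a (suc n) +ℤ sumℤ (map (λ _ → 0ℤ) (upTo (suc n))) ≡⟨ cong (c *ℤ a (suc n) +ℤ_) (sumℤ-map-0 (upTo (suc n))) ⟩
  c *ℤ a (suc n) +ℤ 0ℤ                                   ≡⟨ ℤ.+-identityʳ _ ⟩
  c *ℤ a (suc n)                                         ∎
  where open ≡-Reasoning

⊛-zeroˡ : ∀ a → cst 0ℤ ⊛ a ≗ₛ cst 0ℤ
⊛-zeroˡ a zero    = cst-⊛ 0ℤ a 0
⊛-zeroˡ a (suc n) = cst-⊛ 0ℤ a (suc n)

⊕-identityˡ : ∀ a → cst 0ℤ ⊕ a ≗ₛ a
⊕-identityˡ a zero    = ℤ.+-identityˡ (a 0)
⊕-identityˡ a (suc n) = ℤ.+-identityˡ (a (suc n))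

⊛-identityˡ : ∀ a → cst 1ℤ ⊛ a ≗ₛ a
⊛-identityˡ a n = trans (cst-⊛ 1ℤ a n) (ℤ.*-identityˡ (a n))

2+_ : ℕ → ℕ
2+ n = suc (suc n)

⊛-comm : ∀ a b → a ⊛ b ≗ₛ b ⊛ a
⊛-comm a b zero          = trans (⊛-0 a b) (trans (ℤ.*-comm (a 0) (b 0)) (sym (⊛-0 b a)))
⊛-comm a b (suc zero)    = begin
  (a ⊛ b) 1                       ≡⟨ trans (⊛-suc a b 0) (cong (a 0 *ℤ b 1 +ℤ_) (⊛-0 (tail a) b)) ⟩
  a 0 *ℤ b 1 +ℤ a 1 *ℤ b 0        ≡⟨ solve 4 (λ a₀ a₁ b₀ b₁ → a₀ :* b₁ :+ a₁ :* b₀ := b₀ :* a₁ :+ b₁ :* a₀)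
                                             refl (a 0) (a 1) (b 0) (b 1) ⟩
  b 0 *ℤ a 1 +ℤ b 1 *ℤ a 0        ≡⟨ trans (⊛-suc b a 0) (cong (b 0 *ℤ a 1 +ℤ_) (⊛-0 (tail b) a)) ⟨
  (b ⊛ a) 1                       ∎
  where
  open ≡-Reasoning
  open ℤ-Solver
⊛-comm a b (suc (suc n)) = begin
  (a ⊛ b) (2+ n)                                              ≡⟨ ⊛-suc a b (suc n) ⟩
  a 0 *ℤ b (2+ n) +ℤ (tail a ⊛ b) (suc n)                     ≡⟨ cong (a 0 *ℤ b (2+ n) +ℤ_)
                                                                   (trans (⊛-comm (tail a) b (suc n)) (⊛-suc b (tail a) n)) ⟩
  a 0 *ℤ b (2+ n) +ℤ (b 0 *ℤ a (2+ n) +ℤ (tail b ⊛ tail a) n) ≡⟨ cong (λ z → a 0 *ℤ b (2+ n) +ℤ (b 0 *ℤ a (2+ n) +ℤ z))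
                                                                   (⊛-comm (tail b) (tail a) n) ⟩
  a 0 *ℤ b (2+ n) +ℤ (b 0 *ℤ a (2+ n) +ℤ (tail a ⊛ tail b) n) ≡⟨ solve 3 (λ x y z → x :+ (y :+ z) := y :+ (x :+ z))
                                                                         refl (a 0 *ℤ b (2+ n)) (b 0 *ℤ a (2+ n)) _ ⟩
  b 0 *ℤ a (2+ n) +ℤ (a 0 *ℤ b (2+ n) +ℤ (tail a ⊛ tail b) n) ≡⟨ cong (b 0 *ℤ a (2+ n) +ℤ_)
                                                                   (trans (⊛-comm (tail b) a (suc n)) (⊛-suc a (tail b) n)) ⟨
  b 0 *ℤ a (2+ n) +ℤ (tail b ⊛ a) (suc n)                     ≡⟨ ⊛-suc b a (suc n) ⟨
  (b ⊛ a) (2+ n)                                              ∎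
  where
  open ≡-Reasoning
  open ℤ-Solver

⊛-scaleˡ : ∀ c a b n → ((λ k → c *ℤ a k) ⊛ b) n ≡ c *ℤ (a ⊛ b) n
⊛-scaleˡ c a b n =
  trans (cong sumℤ (map-cong (λ j → ℤ.*-assoc c (a j) (b (n ∸ j))) (upTo (suc n))))
        (sumℤ-map-*ˡ c (λ j → a j *ℤ b (n ∸ j)) (upTo (suc n)))

⊛-assoc : ∀ a b c → (a ⊛ b) ⊛ c ≗ₛ a ⊛ (b ⊛ c)
⊛-assoc a b c zero = begin
  ((a ⊛ b) ⊛ c) 0         ≡⟨ trans (⊛-0 (a ⊛ b) c) (cong (_*ℤ c 0) (⊛-0 a b)) ⟩
  a 0 *ℤ b 0 *ℤ c 0       ≡⟨ ℤ.*-assoc (a 0) (b 0) (c 0) ⟩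
  a 0 *ℤ (b 0 *ℤ c 0)     ≡⟨ trans (⊛-0 a (b ⊛ c)) (cong (a 0 *ℤ_) (⊛-0 b c)) ⟨
  (a ⊛ (b ⊛ c)) 0         ∎
  where open ≡-Reasoning
⊛-assoc a b c (suc n) = begin
  ((a ⊛ b) ⊛ c) (suc n)
    ≡⟨ ⊛-suc (a ⊛ b) c n ⟩
  (a ⊛ b) 0 *ℤ c (suc n) +ℤ (tail (a ⊛ b) ⊛ c) n
    ≡⟨ cong₂ _+ℤ_ (cong (_*ℤ c (suc n)) (⊛-0 a b)) tail-part ⟩
  a 0 *ℤ b 0 *ℤ c (suc n) +ℤ (a 0 *ℤ (tail b ⊛ c) n +ℤ (tail a ⊛ (b ⊛ c)) n)
    ≡⟨ solve 5 (λ x y z w v → x :* y :* z :+ (x :* w :+ v) := x :* (y :* z :+ w) :+ v)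
               refl (a 0) (b 0) (c (suc n)) ((tail b ⊛ c) n) ((tail a ⊛ (b ⊛ c)) n) ⟩
  a 0 *ℤ (b 0 *ℤ c (suc n) +ℤ (tail b ⊛ c) n) +ℤ (tail a ⊛ (b ⊛ c)) n
    ≡⟨ cong (λ z → a 0 *ℤ z +ℤ (tail a ⊛ (b ⊛ c)) n) (⊛-suc b c n) ⟨
  a 0 *ℤ (b ⊛ c) (suc n) +ℤ (tail a ⊛ (b ⊛ c)) n
    ≡⟨ ⊛-suc a (b ⊛ c) n ⟨
  (a ⊛ (b ⊛ c)) (suc n) ∎
  where
  open ≡-Reasoning
  open ℤ-Solver
  tail-part : (tail (a ⊛ b) ⊛ c) n ≡ a 0 *ℤ (tail b ⊛ c) n +ℤ (tail a ⊛ (b ⊛ c)) n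
  tail-part = trans (⊛-cong {b = c} (⊛-suc a b) (λ _ → refl) n)
    (trans (⊛-distribʳ c (λ k → a 0 *ℤ tail b k) (tail a ⊛ b) n)
           (cong₂ _+ℤ_ (⊛-scaleˡ (a 0) (tail b) c n) (⊛-assoc (tail a) b c n)))

series-commutativeSemiring : CommutativeSemiring 0ℓ 0ℓ
series-commutativeSemiring = record
  { Carrier = Series
  ; _≈_ = _≗ₛ_
  ; _+_ = _⊕_
  ; _*_ = _⊛_
  ; 0# = cst 0ℤ
  ; 1# = cst 1ℤ
  ; isCommutativeSemiring = isCommutativeSemiringˡ record
    { +-isCommutativeMonoid = isCommutativeMonoidˡ record
      { isSemigroup = Pointwise.isSemigroup ℕ ℤ.+-isSemigroup
      ; identityˡ = ⊕-identityˡ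
      ; comm = λ a b n → ℤ.+-comm (a n) (b n) }
    ; *-isCommutativeMonoid = isCommutativeMonoidˡ record
      { isSemigroup = record
        { isMagma = record
          { isEquivalence = Pointwise.isEquivalence ℕ isEquivalence
          ; ∙-cong = ⊛-cong }
        ; assoc = ⊛-assoc }
      ; identityˡ = ⊛-identityˡ
      ; comm = ⊛-comm }
    ; distribʳ = ⊛-distribʳ
    ; zeroˡ = ⊛-zeroˡ
    }
  }

xpow-⊛-0 : ∀ m a → (xpow (suc m) ⊛ a) 0 ≡ 0ℤ
xpow-⊛-0 m a = ⊛-0 (xpow (suc m)) a

xpow-⊛-suc : ∀ m a n → (xpow (suc m) ⊛ a) (suc n) ≡ (xpow m ⊛ a) n
xpow-⊛-suc m a n = trans (⊛-suc (xpow (suc m)) a n) (ℤ.+-identityˡ _)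

xpow0≗1 : xpow 0 ≗ₛ cst 1ℤ
xpow0≗1 zero    = refl
xpow0≗1 (suc n) = refl

x⊛-suc : ∀ a n → (xpow 1 ⊛ a) (suc n) ≡ a n
x⊛-suc a n = trans (xpow-⊛-suc 0 a n) (trans (⊛-cong {b = a} xpow0≗1 (λ _ → refl) n) (⊛-identityˡ a n))

1-x 1+x 1+x² : Series
1-x  = cst 1ℤ ⊕ cst (- 1ℤ) ⊛ xpow 1
1+x  = cst 1ℤ ⊕ xpow 1
1+x² = cst 1ℤ ⊕ xpow 2

1-x⊛-coeff : ∀ a n → (1-x ⊛ a) n ≡ a n +ℤ - (xpow 1 ⊛ a) n
1-x⊛-coeff a n = trans (⊛-distribʳ a (cst 1ℤ) (cst (- 1ℤ) ⊛ xpow 1) n)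
  (cong₂ _+ℤ_ (⊛-identityˡ a n)
    (trans (⊛-assoc (cst (- 1ℤ)) (xpow 1) a n) (trans (cst-⊛ (- 1ℤ) (xpow 1 ⊛ a) n) (ℤ.-1*i≡-i _))))

-- Permutations as lists

positions-suc : ∀ n → positions (suc n) ≡ positions n ++ [ suc n ]
positions-suc n = trans (cong (map suc) (sym (upTo-∷ʳ n))) (map-++ suc (upTo n) [ n ])

length-positions : ∀ n → length (positions n) ≡ n
length-positions n = trans (length-map suc (upTo n)) (length-upTo n)

∈-positions⁺ : ∀ {x n} → 1 ≤ x → x ≤ n → x ∈ positions n
∈-positions⁺ {suc i} (s≤s _) i<n = ∈-map⁺ suc (∈-upTo⁺ i<n)

∈-positions⁻ : ∀ {x n} → x ∈ positions n → 1 ≤ x × x ≤ n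
∈-positions⁻ x∈ with ∈-map⁻ suc x∈
... | i , i∈ , refl = s≤s z≤n , ∈-upTo⁻ i∈

positions-unique : ∀ n → Unique (positions n)
positions-unique n = Unique.map⁺ ℕ.suc-injective (Unique.upTo⁺ n)

∈-insertEverywhere⁺ : ∀ x u v → u ++ x ∷ v ∈ insertEverywhere x (u ++ v)
∈-insertEverywhere⁺ x []      []      = here refl
∈-insertEverywhere⁺ x []      (y ∷ v) = here refl
∈-insertEverywhere⁺ x (y ∷ u) v       = there (∈-map⁺ (y ∷_) (∈-insertEverywhere⁺ x u v))

∈-insertEverywhere⁻ : ∀ {x τ} xs → τ ∈ insertEverywhere x xs → ∃₂ λ u v → xs ≡ u ++ v × τ ≡ u ++ x ∷ v
∈-insertEverywhere⁻ []       (here refl) = [] , [] , refl , refl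
∈-insertEverywhere⁻ (y ∷ ys) (here refl) = [] , y ∷ ys , refl , refl
∈-insertEverywhere⁻ (y ∷ ys) (there τ∈) with ∈-map⁻ (y ∷_) τ∈
... | τ′ , τ′∈ , refl with ∈-insertEverywhere⁻ ys τ′∈
... | u , v , refl , refl = y ∷ u , v , refl , refl

insertEverywhere-unique : ∀ x xs → x ∉ xs → Unique (insertEverywhere x xs)
insertEverywhere-unique x []       x∉ = [] ∷ []
insertEverywhere-unique x (y ∷ ys) x∉ =
  All.tabulate (λ τ∈ eq → x∉ (here (head-≢ τ∈ eq)))
    ∷ Unique.map⁺ ∷-injectiveʳ (insertEverywhere-unique x ys (λ x∈ → x∉ (there x∈)))
  where
  head-≢ : ∀ {τ} → τ ∈ map (y ∷_) (insertEverywhere x ys) → x ∷ y ∷ ys ≡ τ → x ≡ y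
  head-≢ τ∈ eq with ∈-map⁻ (y ∷_) τ∈
  ... | _ , _ , refl = ∷-injectiveˡ eq

concatMap-unique : ∀ {A B : Set} (f : A → List B) (key : B → A) {xs} → Unique xs →
                   (∀ {x} → x ∈ xs → Unique (f x)) → (∀ {x y} → x ∈ xs → y ∈ f x → key y ≡ x) →
                   Unique (concatMap f xs)
concatMap-unique f key []         f-unique key-inv = []
concatMap-unique f key {x ∷ xs} (x∉ ∷ xs-unique) f-unique key-inv =
  Unique.++⁺ (f-unique (here refl))
             (concatMap-unique f key xs-unique (λ x∈ → f-unique (there x∈)) (λ x∈ → key-inv (there x∈)))
             disjoint
  where
  disjoint : ∀ {y} → y ∈ f x × y ∈ concatMap f xs → ⊥
  disjoint (y∈fx , y∈rest) with ∈-concat⁻′ (map f xs) y∈rest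
  ... | ys , y∈ys , ys∈ with ∈-map⁻ f ys∈
  ... | x′ , x′∈ , refl = All.lookup x∉ x′∈ (trans (sym (key-inv (here refl) y∈fx)) (key-inv (there x′∈) y∈ys))

∈-perms⁻ : ∀ {τ} n → τ ∈ perms n → τ ↭ positions n
∈-perms⁻ zero    (here refl) = ↭-refl
∈-perms⁻ (suc n) τ∈ with ∈-concat⁻′ (map (insertEverywhere (suc n)) (perms n)) τ∈
... | zs , τ∈zs , zs∈ with ∈-map⁻ (insertEverywhere (suc n)) zs∈
... | xs , xs∈ , refl with ∈-insertEverywhere⁻ xs τ∈zs
... | u , v , refl , refl = ↭-trans (shift (suc n) u v) (↭-trans (prep (suc n) (∈-perms⁻ n xs∈))
                             (↭-trans (∷↭∷ʳ (suc n) (positions n)) (↭-reflexive (sym (positions-suc n)))))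

∈-perms⁺ : ∀ {τ} n → τ ↭ positions n → τ ∈ perms n
∈-perms⁺ {[]}    zero τ↭ = here refl
∈-perms⁺ {_ ∷ _} zero τ↭ with () ← ↭-length τ↭
∈-perms⁺ {τ} (suc n) τ↭ with ∈-∃++ (∈-resp-↭ (↭-sym τ↭) (∈-positions⁺ {suc n} (s≤s z≤n) ℕ.≤-refl))
... | u , v , refl = ∈-concat⁺′ (∈-insertEverywhere⁺ (suc n) u v) (∈-map⁺ (insertEverywhere (suc n)) (∈-perms⁺ n u++v↭))
  where
  u++v↭ : u ++ v ↭ positions n
  u++v↭ = subst (u ++ v ↭_) (++-identityʳ (positions n))
                (drop-mid u (positions n) (subst (u ++ [ suc n ] ++ v ↭_) (positions-suc n) τ↭))

∈-perms⇒≤ : ∀ {xs} n → xs ∈ perms n → All (_≤ n) xs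
∈-perms⇒≤ n xs∈ = All.tabulate (λ x∈ → proj₂ (∈-positions⁻ (∈-resp-↭ (∈-perms⁻ n xs∈) x∈)))

perms-unique : ∀ n → Unique (perms n)
perms-unique zero    = [] ∷ []
perms-unique (suc n) = concatMap-unique (insertEverywhere (suc n)) (filter (ℕ._≤? n)) (perms-unique n)
  (λ {xs} xs∈ → insertEverywhere-unique (suc n) xs (λ n+1∈ → ℕ.n≮n n (All.lookup (∈-perms⇒≤ n xs∈) n+1∈)))
  remove-max
  where
  remove-max : ∀ {xs τ} → xs ∈ perms n → τ ∈ insertEverywhere (suc n) xs → filter (ℕ._≤? n) τ ≡ xs
  remove-max {xs} xs∈ τ∈ with ∈-insertEverywhere⁻ xs τ∈
  ... | u , v , refl , refl = begin
    filter (ℕ._≤? n) (u ++ suc n ∷ v)                   ≡⟨ filter-++ (ℕ._≤? n) u (suc n ∷ v) ⟩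
    filter (ℕ._≤? n) u ++ filter (ℕ._≤? n) (suc n ∷ v)  ≡⟨ cong₂ _++_ (filter-all (ℕ._≤? n) (All.++⁻ˡ u u++v≤n))
                                                            (trans (filter-reject (ℕ._≤? n) (ℕ.n≮n n))
                                                                   (filter-all (ℕ._≤? n) (All.++⁻ʳ u u++v≤n))) ⟩
    u ++ v                                              ∎
    where
    open ≡-Reasoning
    u++v≤n : All (_≤ n) (u ++ v)
    u++v≤n = ∈-perms⇒≤ n xs∈

-- Pattern containment

agree : ℕ → ℕ → List ℕ → List ℕ → Bool
agree x y []        []        = true
agree x y (x′ ∷ xs) (y′ ∷ ys) = not ((x <ᵇ x′) xor (y <ᵇ y′)) ∧ agree x y xs ys
agree x y _         _         = false

sameOrder′ : List ℕ → List ℕ → Bool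
sameOrder′ []       []       = true
sameOrder′ (x ∷ xs) (y ∷ ys) = agree x y xs ys ∧ sameOrder′ xs ys
sameOrder′ _        _        = false

-- The local function `pairwise` of `sameOrder` cannot be referred to;
-- `sameOrder-pairwise` is determined by unification with it.
private
  mutual
    sameOrder-pairwise : ℕ → List ℕ → ℕ → List ℕ → List ℕ → List ℕ → Bool
    sameOrder-pairwise = _

    sameOrder-unfold : ∀ x g a y h b → sameOrder (x ∷ g ∷ a) (y ∷ h ∷ b) ≡
      ((not ((x <ᵇ g) xor (y <ᵇ h)) ∧ sameOrder-pairwise x (g ∷ a) y (h ∷ b) a b) ∧ sameOrder (g ∷ a) (h ∷ b))
    sameOrder-unfold x g a y h b with g ∷ a | h ∷ b
    ... | _ | _ = refl

  sameOrder-pairwise≡agree : ∀ x xs y ys as bs → sameOrder-pairwise x xs y ys as bs ≡ agree x y as bs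
  sameOrder-pairwise≡agree x xs y ys []       []       = refl
  sameOrder-pairwise≡agree x xs y ys (a ∷ as) (b ∷ bs) =
    cong (not ((x <ᵇ a) xor (y <ᵇ b)) ∧_) (sameOrder-pairwise≡agree x xs y ys as bs)
  sameOrder-pairwise≡agree x xs y ys (a ∷ as) []       = refl
  sameOrder-pairwise≡agree x xs y ys []       (b ∷ bs) = refl

sameOrder≡sameOrder′ : ∀ s π → sameOrder s π ≡ sameOrder′ s π
sameOrder≡sameOrder′ []       []       = refl
sameOrder≡sameOrder′ (x ∷ xs) (y ∷ ys) =
  cong₂ _∧_ (sameOrder-pairwise≡agree x xs y ys xs ys) (sameOrder≡sameOrder′ xs ys)
sameOrder≡sameOrder′ (x ∷ xs) []       = refl
sameOrder≡sameOrder′ []       (y ∷ ys) = refl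

T-∧⁻ : ∀ a {b} → T (a ∧ b) → T a × T b
T-∧⁻ a = Equivalence.to T-∧

T-∧⁺ : ∀ {a b} → T a → T b → T (a ∧ b)
T-∧⁺ ta tb = Equivalence.from T-∧ (ta , tb)

<ᵇ-true : ∀ {m n} → m < n → (m <ᵇ n) ≡ true
<ᵇ-true {zero}  {suc n} _         = refl
<ᵇ-true {suc m} {suc n} (s≤s m<n) = <ᵇ-true m<n

<ᵇ-false : ∀ {m n} → n ≤ m → (m <ᵇ n) ≡ false
<ᵇ-false {m}     {zero}  _         = refl
<ᵇ-false {suc m} {suc n} (s≤s n≤m) = <ᵇ-false n≤m

<ᵇ-false⁻ : ∀ m n → T (not (m <ᵇ n)) → n ≤ m
<ᵇ-false⁻ m       zero    _ = z≤n
<ᵇ-false⁻ (suc m) (suc n) t = s≤s (<ᵇ-false⁻ m n t)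

+-<ᵇ-+ : ∀ c x y → ((x + c) <ᵇ (y + c)) ≡ (x <ᵇ y)
+-<ᵇ-+ c zero    zero    = <ᵇ-false {c} ℕ.≤-refl
+-<ᵇ-+ c zero    (suc y) = <ᵇ-true (s≤s (ℕ.m≤n+m c y))
+-<ᵇ-+ c (suc x) zero    = <ᵇ-false (ℕ.m≤n+m c (suc x))
+-<ᵇ-+ c (suc x) (suc y) = +-<ᵇ-+ c x y

sameOrder′⇒length≡ : ∀ s π → T (sameOrder′ s π) → length s ≡ length π
sameOrder′⇒length≡ []      []       _ = refl
sameOrder′⇒length≡ (x ∷ s) (y ∷ π) t = cong suc (sameOrder′⇒length≡ s π (proj₂ (T-∧⁻ (agree x y s π) t)))

agree-mapˡ : ∀ c x y s π → agree (x + c) y (map (_+ c) s) π ≡ agree x y s π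
agree-mapˡ c x y []      []      = refl
agree-mapˡ c x y (a ∷ s) (b ∷ π) rewrite +-<ᵇ-+ c x a = cong (not ((x <ᵇ a) xor (y <ᵇ b)) ∧_) (agree-mapˡ c x y s π)
agree-mapˡ c x y (a ∷ s) []      = refl
agree-mapˡ c x y []      (b ∷ π) = refl

agree-mapʳ : ∀ c x y s π → agree x (y + c) s (map (_+ c) π) ≡ agree x y s π
agree-mapʳ c x y []      []      = refl
agree-mapʳ c x y (a ∷ s) (b ∷ π) rewrite +-<ᵇ-+ c y b = cong (not ((x <ᵇ a) xor (y <ᵇ b)) ∧_) (agree-mapʳ c x y s π)
agree-mapʳ c x y (a ∷ s) []      = refl
agree-mapʳ c x y []      (b ∷ π) = refl

sameOrder′-mapˡ : ∀ c s π → sameOrder′ (map (_+ c) s) π ≡ sameOrder′ s π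
sameOrder′-mapˡ c []      []      = refl
sameOrder′-mapˡ c (x ∷ s) (y ∷ π) = cong₂ _∧_ (agree-mapˡ c x y s π) (sameOrder′-mapˡ c s π)
sameOrder′-mapˡ c (x ∷ s) []      = refl
sameOrder′-mapˡ c []      (y ∷ π) = refl

sameOrder′-mapʳ : ∀ c s π → sameOrder′ s (map (_+ c) π) ≡ sameOrder′ s π
sameOrder′-mapʳ c []      []      = refl
sameOrder′-mapʳ c (x ∷ s) (y ∷ π) = cong₂ _∧_ (agree-mapʳ c x y s π) (sameOrder′-mapʳ c s π)
sameOrder′-mapʳ c (x ∷ s) []      = refl
sameOrder′-mapʳ c []      (y ∷ π) = refl

agree-≥ : ∀ x y s π → All (_≤ x) s → All (_≤ y) π → length s ≡ length π → T (agree x y s π)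
agree-≥ x y []      []      _          _          _ = _
agree-≥ x y (a ∷ s) (b ∷ π) (a≤x ∷ s≤) (b≤y ∷ π≤) e
  rewrite <ᵇ-false {x} {a} a≤x | <ᵇ-false {y} {b} b≤y = agree-≥ x y s π s≤ π≤ (ℕ.suc-injective e)

agree-<⇒< : ∀ x y s π → T (agree x y s π) → All (x <_) s → All (y <_) π
agree-<⇒< x y []      []      _ _           = []
agree-<⇒< x y (a ∷ s) (b ∷ π) t (x<a ∷ x<s) with T-∧⁻ (not ((x <ᵇ a) xor (y <ᵇ b))) t
... | t₁ , t₂ rewrite <ᵇ-true x<a = ℕ.<ᵇ⇒< y b (xnor-true (y <ᵇ b) t₁) ∷ agree-<⇒< x y s π t₂ x<s
  where
  xnor-true : ∀ c → T (not (true xor c)) → T c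
  xnor-true true _ = _

agree-≥⇒≥ : ∀ x y s π → T (agree x y s π) → All (_≤ x) s → All (_≤ y) π
agree-≥⇒≥ x y []      []      _ _           = []
agree-≥⇒≥ x y (a ∷ s) (b ∷ π) t (a≤x ∷ s≤x) with T-∧⁻ (not ((x <ᵇ a) xor (y <ᵇ b))) t
... | t₁ , t₂ rewrite <ᵇ-false {x} {a} a≤x = <ᵇ-false⁻ y b t₁ ∷ agree-≥⇒≥ x y s π t₂ s≤x

agree-++ : ∀ x y s₁ s₂ p₁ p₂ → length s₁ ≡ length p₁ →
           agree x y (s₁ ++ s₂) (p₁ ++ p₂) ≡ agree x y s₁ p₁ ∧ agree x y s₂ p₂
agree-++ x y []       s₂ []       p₂ _ = refl
agree-++ x y (a ∷ s₁) s₂ (b ∷ p₁) p₂ e rewrite agree-++ x y s₁ s₂ p₁ p₂ (ℕ.suc-injective e) =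
  sym (∧-assoc (not ((x <ᵇ a) xor (y <ᵇ b))) (agree x y s₁ p₁) (agree x y s₂ p₂))

cross : List ℕ → List ℕ → List ℕ → List ℕ → Bool
cross []       s₂ []       p₂ = true
cross (x ∷ s₁) s₂ (y ∷ p₁) p₂ = agree x y s₂ p₂ ∧ cross s₁ s₂ p₁ p₂
cross _        _  _        _  = false

sameOrder′-++⁻ : ∀ s₁ s₂ p₁ p₂ → length s₁ ≡ length p₁ → T (sameOrder′ (s₁ ++ s₂) (p₁ ++ p₂)) →
                 (T (sameOrder′ s₁ p₁) × T (sameOrder′ s₂ p₂)) × T (cross s₁ s₂ p₁ p₂)
sameOrder′-++⁻ []       s₂ []       p₂ _ t = (_ , t) , _
sameOrder′-++⁻ (x ∷ s₁) s₂ (y ∷ p₁) p₂ e t with T-∧⁻ (agree x y (s₁ ++ s₂) (p₁ ++ p₂)) t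
... | t₁ , t₂ with sameOrder′-++⁻ s₁ s₂ p₁ p₂ (ℕ.suc-injective e) t₂
... | (u₁ , u₂) , c rewrite agree-++ x y s₁ s₂ p₁ p₂ (ℕ.suc-injective e) with T-∧⁻ (agree x y s₁ p₁) t₁
... | v₁ , v₂ = (T-∧⁺ v₁ u₁ , u₂) , T-∧⁺ v₂ c

sameOrder′-++⁺ : ∀ s₁ s₂ p₁ p₂ → length s₁ ≡ length p₁ →
                 T (sameOrder′ s₁ p₁) → T (sameOrder′ s₂ p₂) → T (cross s₁ s₂ p₁ p₂) →
                 T (sameOrder′ (s₁ ++ s₂) (p₁ ++ p₂))
sameOrder′-++⁺ []       s₂ []       p₂ _ _  t₂ _ = t₂
sameOrder′-++⁺ (x ∷ s₁) s₂ (y ∷ p₁) p₂ e t₁ t₂ c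
  with T-∧⁻ (agree x y s₁ p₁) t₁ | T-∧⁻ (agree x y s₂ p₂) c
... | u₁ , u₂ | c₁ , c₂ rewrite agree-++ x y s₁ s₂ p₁ p₂ (ℕ.suc-injective e) =
  T-∧⁺ (T-∧⁺ u₁ c₁) (sameOrder′-++⁺ s₁ s₂ p₁ p₂ (ℕ.suc-injective e) u₂ t₂ c₂)

cross-< : ∀ s₁ s₂ p₁ p₂ → T (cross s₁ s₂ p₁ p₂) →
          All (λ a → All (a <_) s₂) s₁ → All (λ b → All (b <_) p₂) p₁
cross-< []       s₂ []       p₂ _ _          = []
cross-< (x ∷ s₁) s₂ (y ∷ p₁) p₂ c (x< ∷ s₁<) with T-∧⁻ (agree x y s₂ p₂) c
... | c₁ , c₂ = agree-<⇒< x y s₂ p₂ c₁ x< ∷ cross-< s₁ s₂ p₁ p₂ c₂ s₁<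

cross-≥ : ∀ s₁ s₂ p₁ p₂ → T (cross s₁ s₂ p₁ p₂) →
          All (λ a → All (_≤ a) s₂) s₁ → All (λ b → All (_≤ b) p₂) p₁
cross-≥ []       s₂ []       p₂ _ _          = []
cross-≥ (x ∷ s₁) s₂ (y ∷ p₁) p₂ c (x≥ ∷ s₁≥) with T-∧⁻ (agree x y s₂ p₂) c
... | c₁ , c₂ = agree-≥⇒≥ x y s₂ p₂ c₁ x≥ ∷ cross-≥ s₁ s₂ p₁ p₂ c₂ s₁≥

cross-≥⁺ : ∀ s₁ s₂ p₁ p₂ → All (λ a → All (_≤ a) s₂) s₁ → All (λ b → All (_≤ b) p₂) p₁ →
           length s₁ ≡ length p₁ → length s₂ ≡ length p₂ → T (cross s₁ s₂ p₁ p₂)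
cross-≥⁺ []       s₂ []       p₂ _          _          _  _  = _
cross-≥⁺ (x ∷ s₁) s₂ (y ∷ p₁) p₂ (x≥ ∷ s₁≥) (y≥ ∷ p₁≥) e₁ e₂ =
  T-∧⁺ (agree-≥ x y s₂ p₂ x≥ y≥ e₂) (cross-≥⁺ s₁ s₂ p₁ p₂ s₁≥ p₁≥ (ℕ.suc-injective e₁) e₂)

Contains : List ℕ → List ℕ → Set
Contains π τ = ∃[ s ] s ⊆ τ × T (sameOrder′ s π)

∈-subseqs⁺ : ∀ {s τ : List ℕ} → s ⊆ τ → s ∈ subseqs (length s) τ
∈-subseqs⁺ []                          = here refl
∈-subseqs⁺ {[]}            (y ∷ʳ s⊆τ)  = here refl
∈-subseqs⁺ {x ∷ s} {y ∷ τ} (.y ∷ʳ s⊆τ) = ∈-++⁺ʳ (map (y ∷_) (subseqs (length s) τ)) (∈-subseqs⁺ s⊆τ)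
∈-subseqs⁺ (refl ∷ s⊆τ)                = ∈-++⁺ˡ (∈-map⁺ (_ ∷_) (∈-subseqs⁺ s⊆τ))

∈-subseqs⁻ : ∀ {s} m (τ : List ℕ) → s ∈ subseqs m τ → s ⊆ τ
∈-subseqs⁻ zero    τ       (here refl) = minimum τ
∈-subseqs⁻ (suc m) (x ∷ τ) s∈ with ∈-++⁻ (map (x ∷_) (subseqs m τ)) s∈
... | inj₂ s∈′ = x ∷ʳ ∈-subseqs⁻ (suc m) τ s∈′
... | inj₁ s∈′ with ∈-map⁻ (x ∷_) s∈′
...   | s′ , s′∈ , refl = refl ∷ ∈-subseqs⁻ m τ s′∈

contains-reflects : ∀ π τ → Reflects (Contains π τ) (contains π τ)
contains-reflects π τ = fromEquivalence sound complete
  where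
  sound : T (contains π τ) → Contains π τ
  sound t with find (any⁻ (λ s → sameOrder s π) (subseqs (length π) τ) t)
  ... | s , s∈ , ts = s , ∈-subseqs⁻ (length π) τ s∈ , subst T (sameOrder≡sameOrder′ s π) ts
  complete : Contains π τ → T (contains π τ)
  complete (s , s⊆τ , ts) = any⁺ (λ s → sameOrder s π)
    (lose (subst (λ m → s ∈ subseqs m τ) (sameOrder′⇒length≡ s π ts) (∈-subseqs⁺ s⊆τ))
          (subst T (sym (sameOrder≡sameOrder′ s π)) ts))

avoids-reflects : ∀ π τ → Reflects (¬ Contains π τ) (avoids π τ)
avoids-reflects π τ = ¬-reflects (contains-reflects π τ)

Contains⇒avoids≡false : ∀ {π τ} → Contains π τ → avoids π τ ≡ false
Contains⇒avoids≡false {π} {τ} c = det (avoids-reflects π τ) (ofⁿ (λ ¬c → ¬c c))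

avoids⇒¬Contains : ∀ {π τ} → T (avoids π τ) → ¬ Contains π τ
avoids⇒¬Contains {π} {τ} t with avoids π τ | avoids-reflects π τ
... | true | ofʸ ¬c = ¬c

¬Contains⇒avoids : ∀ {π τ} → ¬ Contains π τ → T (avoids π τ)
¬Contains⇒avoids {π} {τ} ¬c with avoids π τ | avoids-reflects π τ
... | true  | _       = _
... | false | ofⁿ ¬¬c = ¬¬c ¬c

reflects-map : ∀ {A B : Set} {b} → (A → B) → (B → A) → Reflects A b → Reflects B b
reflects-map f g (ofʸ a)  = ofʸ (f a)
reflects-map f g (ofⁿ ¬a) = ofⁿ (¬a ∘ g)

avoids-cong : ∀ {π τ π′ τ′} → (Contains π τ → Contains π′ τ′) → (Contains π′ τ′ → Contains π τ) →
              avoids π τ ≡ avoids π′ τ′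
avoids-cong {π} {τ} {π′} {τ′} f g =
  det (avoids-reflects π τ) (reflects-map (_∘ f) (_∘ g) (avoids-reflects π′ τ′))

avoids-∧ : ∀ {π τ π₁ τ₁ π₂ τ₂} → (Contains π τ → Contains π₁ τ₁ ⊎ Contains π₂ τ₂) →
           (Contains π₁ τ₁ → Contains π τ) → (Contains π₂ τ₂ → Contains π τ) →
           avoids π τ ≡ avoids π₁ τ₁ ∧ avoids π₂ τ₂
avoids-∧ {π} {τ} {π₁} {τ₁} {π₂} {τ₂} split g₁ g₂ =
  det (avoids-reflects π τ)
      (reflects-map (λ (¬c₁ , ¬c₂) c → [ ¬c₁ , ¬c₂ ]′ (split c)) (λ ¬c → ¬c ∘ g₁ , ¬c ∘ g₂)
                    (avoids-reflects π₁ τ₁ ×-reflects avoids-reflects π₂ τ₂))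

⊆-++⁻ : ∀ {s} (xs ys : List ℕ) → s ⊆ xs ++ ys → ∃₂ λ s₁ s₂ → s ≡ s₁ ++ s₂ × s₁ ⊆ xs × s₂ ⊆ ys
⊆-++⁻ []       ys s⊆           = [] , _ , refl , [] , s⊆
⊆-++⁻ (x ∷ xs) ys (.x ∷ʳ s⊆)   with ⊆-++⁻ xs ys s⊆
... | s₁ , s₂ , refl , s₁⊆ , s₂⊆ = s₁ , s₂ , refl , x ∷ʳ s₁⊆ , s₂⊆
⊆-++⁻ (x ∷ xs) ys (refl ∷ s⊆) with ⊆-++⁻ xs ys s⊆
... | s₁ , s₂ , refl , s₁⊆ , s₂⊆ = x ∷ s₁ , s₂ , refl , refl ∷ s₁⊆ , s₂⊆

⊆-map⁻ : ∀ {s} (f : ℕ → ℕ) xs → s ⊆ map f xs → ∃ λ s′ → s ≡ map f s′ × s′ ⊆ xs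
⊆-map⁻ f []       []           = [] , refl , []
⊆-map⁻ f (x ∷ xs) (_ ∷ʳ s⊆)    with ⊆-map⁻ f xs s⊆
... | s′ , refl , s′⊆ = s′ , refl , x ∷ʳ s′⊆
⊆-map⁻ f (x ∷ xs) (refl ∷ s⊆) with ⊆-map⁻ f xs s⊆
... | s′ , refl , s′⊆ = x ∷ s′ , refl , refl ∷ s′⊆

⊆-[_] : ∀ {s} (x : ℕ) → s ⊆ [ x ] → s ≡ [] ⊎ s ≡ [ x ]
⊆-[ x ] (_ ∷ʳ [])  = inj₁ refl
⊆-[ x ] (refl ∷ []) = inj₂ refl

splitAt-length : ∀ (s₁ s₂ π : List ℕ) → length (s₁ ++ s₂) ≡ length π →
                 ∃₂ λ p₁ p₂ → π ≡ p₁ ++ p₂ × length s₁ ≡ length p₁ × length s₂ ≡ length p₂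
splitAt-length []       s₂ π       e = [] , π , refl , refl , e
splitAt-length (x ∷ s₁) s₂ (y ∷ π) e with splitAt-length s₁ s₂ π (ℕ.suc-injective e)
... | p₁ , p₂ , refl , e₁ , e₂ = y ∷ p₁ , p₂ , refl , cong suc e₁ , e₂

Contains-⊆ : ∀ {π xs ys} → Contains π xs → xs ⊆ ys → Contains π ys
Contains-⊆ (s , s⊆ , t) xs⊆ = s , ⊆-trans s⊆ xs⊆ , t

Contains-map⁺ : ∀ {π} c xs → Contains π xs → Contains π (map (_+ c) xs)
Contains-map⁺ {π} c xs (s , s⊆ , t) = map (_+ c) s , ⊆-map⁺ (_+ c) s⊆ , subst T (sym (sameOrder′-mapˡ c s π)) t

Contains-map⁻ : ∀ {π} c xs → Contains π (map (_+ c) xs) → Contains π xs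
Contains-map⁻ {π} c xs (s , s⊆ , t) with ⊆-map⁻ (_+ c) xs s⊆
... | s′ , refl , s′⊆ = s′ , s′⊆ , subst T (sameOrder′-mapˡ c s′ π) t

Contains-pattern-map⁻ : ∀ {π τ} c → Contains (map (_+ c) π) τ → Contains π τ
Contains-pattern-map⁻ {π} c (s , s⊆ , t) = s , s⊆ , subst T (sameOrder′-mapʳ c s π) t

Contains⇒length≤ : ∀ {π xs} → Contains π xs → length π ≤ length xs
Contains⇒length≤ {π} (s , s⊆ , t) = subst (_≤ _) (sameOrder′⇒length≡ s π t) (Sublist.length-mono-≤ s⊆)

Contains-tail : ∀ {b π xs} → Contains (b ∷ π) xs → Contains π xs
Contains-tail {b} {π} (x ∷ s , s⊆ , t) = s , ⊆-trans (x ∷ʳ ⊆-refl) s⊆ , proj₂ (T-∧⁻ (agree x b s π) t)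

Contains-++⁻ˡ : ∀ {p₁ p₂ xs} → Contains (p₁ ++ p₂) xs → Contains p₁ xs
Contains-++⁻ˡ {p₁} {p₂} (s , s⊆ , t) with splitAt-length p₁ p₂ s (sym (sameOrder′⇒length≡ s (p₁ ++ p₂) t))
... | s₁ , s₂ , refl , e , _ =
  s₁ , ⊆-trans (Sublist.++ʳ s₂ ⊆-refl) s⊆ , proj₁ (proj₁ (sameOrder′-++⁻ s₁ s₂ p₁ p₂ (sym e) t))

SumIndecomposable : List ℕ → Set
SumIndecomposable π = ∀ p₁ p₂ → p₁ ++ p₂ ≡ π → p₁ ≢ [] → p₂ ≢ [] → ¬ All (λ b → All (b <_) p₂) p₁

Contains-++ : ∀ {π} xs ys → SumIndecomposable π → All (λ x → All (x <_) ys) xs →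
              Contains π (xs ++ ys) → Contains π xs ⊎ Contains π ys
Contains-++ {π} xs ys indec xs<ys (s , s⊆ , t) with ⊆-++⁻ xs ys s⊆
... | s₁ , [] , refl , s₁⊆ , _ = inj₁ (s₁ , s₁⊆ , subst (λ z → T (sameOrder′ z π)) (++-identityʳ s₁) t)
... | [] , s₂ , refl , _ , s₂⊆ = inj₂ (s₂ , s₂⊆ , t)
... | s₁@(_ ∷ _) , s₂@(_ ∷ _) , refl , s₁⊆ , s₂⊆
  with splitAt-length s₁ s₂ π (sameOrder′⇒length≡ (s₁ ++ s₂) π t)
... | p₁ , p₂ , refl , e₁ , e₂ = ⊥-elim (indec p₁ p₂ refl (nonempty s₁ p₁ e₁ λ ()) (nonempty s₂ p₂ e₂ λ ())
        (cross-< s₁ s₂ p₁ p₂ (proj₂ (sameOrder′-++⁻ s₁ s₂ p₁ p₂ e₁ t))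
                 (All.map (All-resp-⊆ s₂⊆) (All-resp-⊆ s₁⊆ xs<ys))))
  where
  nonempty : ∀ (s p : List ℕ) → length s ≡ length p → s ≢ [] → p ≢ []
  nonempty s []      e s≢[] refl with [] ← s = s≢[] refl
  nonempty s (_ ∷ _) e s≢[] ()

Contains-∷⁻ : ∀ {b π m xs} → Contains (b ∷ π) (m ∷ xs) → Contains (b ∷ π) xs ⊎ Contains π xs
Contains-∷⁻ (s , _ ∷ʳ s⊆ , t) = inj₁ (s , s⊆ , t)
Contains-∷⁻ {b} {π} {m} (m ∷ s , refl ∷ s⊆ , t) = inj₂ (s , s⊆ , proj₂ (T-∧⁻ (agree m b s π) t))

Contains-∷⁺ : ∀ {b π m xs} → All (_≤ m) xs → All (_≤ b) π → Contains π xs → Contains (b ∷ π) (m ∷ xs)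
Contains-∷⁺ {b} {π} {m} xs≤m π≤b (s , s⊆ , t) =
  m ∷ s , refl ∷ s⊆ , T-∧⁺ (agree-≥ m b s π (All-resp-⊆ s⊆ xs≤m) π≤b (sameOrder′⇒length≡ s π t)) t

Contains-max∷ : ∀ {b c π m xs} → All (_≤ m) xs → b < c → Contains (b ∷ c ∷ π) (m ∷ xs) → Contains (b ∷ c ∷ π) xs
Contains-max∷ xs≤m b<c (s , _ ∷ʳ s⊆ , t) = s , s⊆ , t
Contains-max∷ {b} {c} {π} {m} xs≤m b<c (m ∷ x ∷ s , refl ∷ s⊆ , t)
  with T-∧⁻ (agree m b (x ∷ s) (c ∷ π)) t
... | t₁ , _ with T-∧⁻ (not ((m <ᵇ x) xor (b <ᵇ c))) t₁
... | t₂ , _ rewrite <ᵇ-true b<c =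
  ⊥-elim (ℕ.<⇒≱ (ℕ.<ᵇ⇒< m x (xnor-true (m <ᵇ x) t₂)) (All.head (All-resp-⊆ s⊆ xs≤m)))
  where
  xnor-true : ∀ a → T (not (a xor true)) → T a
  xnor-true true _ = _

Contains-∷ʳ⁻ : ∀ {π x} xs → All (x ≤_) xs → Contains π (xs ++ [ x ]) →
               Contains π xs ⊎ ∃₂ λ p q → π ≡ p ++ [ q ] × All (q ≤_) p × Contains p xs
Contains-∷ʳ⁻ {π} {x} xs x≤xs (s , s⊆ , t) with ⊆-++⁻ xs [ x ] s⊆
... | s₁ , s₂ , refl , s₁⊆ , s₂⊆ with ⊆-[ x ] s₂⊆
... | inj₁ refl = inj₁ (s₁ , s₁⊆ , subst (λ z → T (sameOrder′ z π)) (++-identityʳ s₁) t)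
... | inj₂ refl with splitAt-length s₁ [ x ] π (sameOrder′⇒length≡ (s₁ ++ [ x ]) π t)
... | p , q ∷ [] , refl , e , _ with sameOrder′-++⁻ s₁ [ x ] p [ q ] e t
... | (t₁ , _) , c = inj₂ (p , q , refl ,
        All.map All.head (cross-≥ s₁ [ x ] p [ q ] c (All.map (_∷ []) (All-resp-⊆ s₁⊆ x≤xs))) , s₁ , s₁⊆ , t₁)

-- Involutions

infixr 5 _⊞_
_⊞_ : List ℕ → List ℕ → List ℕ
σ ⊞ ρ = σ ++ map (_+ length σ) ρ

-- arc σ = (m, σ₁ + 1, …, σₖ + 1, 1) with m = k + 2: the 2-cycle (1 m) drawn over σ
arc : List ℕ → List ℕ
arc σ = suc (suc (length σ)) ∷ (map (_+ 1) σ ++ [ 1 ])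

InRange : ℕ → List ℕ → Set
InRange n τ = All (λ x → 1 ≤ x × x ≤ n) τ

Positive : List ℕ → Set
Positive = All (1 ≤_)

length-⊞ : ∀ σ ρ → length (σ ⊞ ρ) ≡ length σ + length ρ
length-⊞ σ ρ = trans (length-++ σ) (cong (length σ +_) (length-map (_+ length σ) ρ))

length-arc : ∀ σ → length (arc σ) ≡ suc (suc (length σ))
length-arc σ = cong suc (trans (length-++ (map (_+ 1) σ)) (trans (cong (_+ 1) (length-map (_+ 1) σ)) (ℕ.+-comm (length σ) 1)))

map-+1-positive : ∀ xs → Positive (map (_+ 1) xs)
map-+1-positive []       = []
map-+1-positive (x ∷ xs) = subst (1 ≤_) (ℕ.+-comm 1 x) (s≤s z≤n) ∷ map-+1-positive xs

arc-tail-bounded : ∀ σ → InRange (length σ) σ → All (_< suc (suc (length σ))) (map (_+ 1) σ ++ [ 1 ])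
arc-tail-bounded σ σ-range = All.++⁺ (All.map⁺ (All.map bound σ-range)) (s≤s (s≤s z≤n) ∷ [])
  where
  bound : ∀ {x} → 1 ≤ x × x ≤ length σ → x + 1 < suc (suc (length σ))
  bound {x} (_ , x≤) = s≤s (subst (_≤ suc (length σ)) (ℕ.+-comm 1 x) (s≤s x≤))

arc-bounded : ∀ σ → InRange (length σ) σ → All (_≤ length (arc σ)) (arc σ)
arc-bounded σ σ-range = subst (λ m → All (_≤ m) (arc σ)) (sym (length-arc σ))
  (ℕ.≤-refl ∷ All.map ℕ.<⇒≤ (arc-tail-bounded σ σ-range))

⊞-below : ∀ σ ρ → All (_≤ length σ) σ → Positive ρ → All (λ a → All (a <_) (map (_+ length σ) ρ)) σ
⊞-below σ ρ σ≤ ρ-pos =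
  All.map (λ a≤ → All.map⁺ (All.map (λ 1≤r → ℕ.≤-trans (s≤s a≤) (ℕ.+-monoˡ-≤ (length σ) 1≤r)) ρ-pos)) σ≤

Position : List ℕ → ℕ → Set
Position τ i = 1 ≤ i × i ≤ length τ

at-suc : ∀ x xs i → 1 ≤ i → at (x ∷ xs) (suc i) ≡ at xs i
at-suc x xs (suc i) _ = refl

All-at : ∀ {P : ℕ → Set} τ → All P τ → ∀ i → Position τ i → P (at τ i)
All-at (x ∷ xs) (px ∷ pxs) (suc zero)    _            = px
All-at (x ∷ xs) (px ∷ pxs) (suc (suc i)) (_ , s≤s i≤) = All-at xs pxs (suc i) (s≤s z≤n , i≤)

at-All : ∀ {P : ℕ → Set} τ → (∀ i → Position τ i → P (at τ i)) → All P τ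
at-All []       f = []
at-All (x ∷ xs) f =
  f 1 (s≤s z≤n , s≤s z≤n) ∷ at-All xs (λ { (suc i) (_ , i≤) → f (suc (suc i)) (s≤s z≤n , s≤s i≤) })

at-∈ : ∀ τ i → Position τ i → at τ i ∈ τ
at-∈ (x ∷ xs) (suc zero)    _            = here refl
at-∈ (x ∷ xs) (suc (suc i)) (_ , s≤s i≤) = there (at-∈ xs (suc i) (s≤s z≤n , i≤))

∈⇒at : ∀ {x} τ → x ∈ τ → ∃ λ i → Position τ i × at τ i ≡ x
∈⇒at (y ∷ ys) (here refl) = 1 , (s≤s z≤n , s≤s z≤n) , refl
∈⇒at (y ∷ ys) (there x∈) with ∈⇒at ys x∈
... | suc i , (_ , i≤) , eq = suc (suc i) , (s≤s z≤n , s≤s i≤) , eq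

at-++ˡ : ∀ xs ys i → i ≤ length xs → at (xs ++ ys) i ≡ at xs i
at-++ˡ []       []       zero          _        = refl
at-++ˡ []       (y ∷ ys) zero          _        = refl
at-++ˡ (x ∷ xs) ys       zero          _        = refl
at-++ˡ (x ∷ xs) ys       (suc zero)    _        = refl
at-++ˡ (x ∷ xs) ys       (suc (suc i)) (s≤s i≤) = at-++ˡ xs ys (suc i) i≤

at-++ʳ : ∀ xs ys j → 1 ≤ j → at (xs ++ ys) (length xs + j) ≡ at ys j
at-++ʳ []       ys j       _   = refl
at-++ʳ (x ∷ xs) ys (suc j) 1≤j = begin
  at (x ∷ xs ++ ys) (suc (length xs + suc j)) ≡⟨ at-suc x (xs ++ ys) (length xs + suc j)
                                                         (ℕ.≤-trans 1≤j (ℕ.m≤n+m (suc j) (length xs))) ⟩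
  at (xs ++ ys) (length xs + suc j)           ≡⟨ at-++ʳ xs ys (suc j) 1≤j ⟩
  at ys (suc j)                               ∎
  where open ≡-Reasoning

at-map : ∀ (f : ℕ → ℕ) xs i → Position xs i → at (map f xs) i ≡ f (at xs i)
at-map f (x ∷ xs) (suc zero)    _            = refl
at-map f (x ∷ xs) (suc (suc i)) (_ , s≤s i≤) = at-map f xs (suc i) (s≤s z≤n , i≤)

Involutive : List ℕ → Set
Involutive τ = ∀ i → Position τ i → at τ (at τ i) ≡ i

isInvolution⇒Involutive : ∀ τ → T (isInvolution τ) → Involutive τ
isInvolution⇒Involutive τ t i (1≤i , i≤) =
  ℕ.≡ᵇ⇒≡ _ i (All.lookup (All.all⁺ _ (positions (length τ)) t) (∈-positions⁺ 1≤i i≤))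

Involutive⇒isInvolution : ∀ τ → Involutive τ → T (isInvolution τ)
Involutive⇒isInvolution τ inv =
  All.all⁻ _ (All.tabulate (λ {i} i∈ → ℕ.≡⇒≡ᵇ _ i (inv i (∈-positions⁻ i∈))))

↭-unique : ∀ {A : Set} {xs ys : List A} → Unique xs → Unique ys →
           (∀ {x} → x ∈ xs → x ∈ ys) → (∀ {x} → x ∈ ys → x ∈ xs) → xs ↭ ys
↭-unique xs! ys! xs⊆ys ys⊆xs = ∼bag⇒↭ (unique∧set⇒bag xs! ys! (mk⇔ xs⊆ys ys⊆xs))

at-injective⇒Unique : ∀ τ → (∀ i j → Position τ i → Position τ j → at τ i ≡ at τ j → i ≡ j) → Unique τ
at-injective⇒Unique []       _   = []
at-injective⇒Unique (x ∷ xs) inj = All.tabulate head-distinct ∷ at-injective⇒Unique xs tail-injective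
  where
  position-suc : ∀ {i} → Position xs i → Position (x ∷ xs) (suc i)
  position-suc (_ , i≤) = s≤s z≤n , s≤s i≤
  tail-injective : ∀ i j → Position xs i → Position xs j → at xs i ≡ at xs j → i ≡ j
  tail-injective i j pi pj eq = ℕ.suc-injective (inj (suc i) (suc j) (position-suc pi) (position-suc pj)
    (trans (at-suc x xs i (proj₁ pi)) (trans eq (sym (at-suc x xs j (proj₁ pj))))))
  head-distinct : ∀ {y} → y ∈ xs → x ≢ y
  head-distinct y∈ x≡y with ∈⇒at xs y∈
  ... | suc j , pj , eq with inj 1 (suc (suc j)) (s≤s z≤n , s≤s z≤n) (position-suc pj) (trans x≡y (sym eq))
  ... | ()

Involutive⇒Unique : ∀ τ → Involutive τ → Unique τ
Involutive⇒Unique τ inv = at-injective⇒Unique τ (λ i j pi pj eq → trans (sym (inv i pi)) (trans (cong (at τ) eq) (inv j pj)))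

Involutive⇒↭positions : ∀ n τ → length τ ≡ n → InRange n τ → Involutive τ → τ ↭ positions n
Involutive⇒↭positions n τ refl τ-range inv = ↭-unique (Involutive⇒Unique τ inv) (positions-unique (length τ))
  (λ x∈ → let (1≤x , x≤) = All.lookup τ-range x∈ in ∈-positions⁺ 1≤x x≤)
  (λ {x} x∈ → let px = ∈-positions⁻ x∈ in subst (_∈ τ) (inv x px) (at-∈ τ (at τ x) (All-at τ τ-range x px)))

InRange-⊞ : ∀ σ ρ → InRange (length σ) σ → InRange (length ρ) ρ → InRange (length σ + length ρ) (σ ⊞ ρ)
InRange-⊞ σ ρ σ-range ρ-range = All.++⁺
  (All.map (λ (1≤x , x≤) → 1≤x , ℕ.≤-trans x≤ (ℕ.m≤m+n (length σ) (length ρ))) σ-range)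
  (All.map⁺ (All.map (λ {x} (1≤x , x≤) → ℕ.≤-trans 1≤x (ℕ.m≤m+n x (length σ)) ,
                       subst (x + length σ ≤_) (ℕ.+-comm (length ρ) (length σ)) (ℕ.+-monoˡ-≤ (length σ) x≤)) ρ-range))

Involutive-⊞ : ∀ σ ρ → Involutive σ → InRange (length σ) σ → Involutive ρ → InRange (length ρ) ρ →
               Involutive (σ ⊞ ρ)
Involutive-⊞ σ ρ σ-inv σ-range ρ-inv ρ-range i (1≤i , i≤) with i ℕ.≤? length σ
... | yes i≤σ = begin
  at (σ ⊞ ρ) (at (σ ⊞ ρ) i) ≡⟨ cong (at (σ ⊞ ρ)) (at-++ˡ σ _ i i≤σ) ⟩
  at (σ ⊞ ρ) (at σ i)       ≡⟨ at-++ˡ σ _ (at σ i) (proj₂ (All-at σ σ-range i (1≤i , i≤σ))) ⟩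
  at σ (at σ i)             ≡⟨ σ-inv i (1≤i , i≤σ) ⟩
  i                         ∎
  where open ≡-Reasoning
... | no i≰σ = begin
  at (σ ⊞ ρ) (at (σ ⊞ ρ) i)       ≡⟨ cong (λ k → at (σ ⊞ ρ) (at (σ ⊞ ρ) k)) l+j≡i ⟨
  at (σ ⊞ ρ) (at (σ ⊞ ρ) (l + j)) ≡⟨ cong (at (σ ⊞ ρ)) (at-right j pj) ⟩
  at (σ ⊞ ρ) (at ρ j + l)         ≡⟨ cong (at (σ ⊞ ρ)) (ℕ.+-comm (at ρ j) l) ⟩
  at (σ ⊞ ρ) (l + at ρ j)         ≡⟨ at-right (at ρ j) (All-at ρ ρ-range j pj) ⟩
  at ρ (at ρ j) + l               ≡⟨ cong (_+ l) (ρ-inv j pj) ⟩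
  j + l                           ≡⟨ ℕ.+-comm j l ⟩
  l + j                           ≡⟨ l+j≡i ⟩
  i                               ∎
  where
  open ≡-Reasoning
  l j : ℕ
  l = length σ
  j = i ∸ l
  l<i : l < i
  l<i = ℕ.≰⇒> i≰σ
  l+j≡i : l + j ≡ i
  l+j≡i = ℕ.m+[n∸m]≡n (ℕ.<⇒≤ l<i)
  pj : Position ρ j
  pj = ℕ.m<n⇒0<n∸m l<i ,
       ℕ.+-cancelˡ-≤ l j (length ρ) (subst (_≤ l + length ρ) (sym l+j≡i) (subst (i ≤_) (length-⊞ σ ρ) i≤))
  at-right : ∀ k → Position ρ k → at (σ ⊞ ρ) (l + k) ≡ at ρ k + l
  at-right k pk = trans (at-++ʳ σ (map (_+ l) ρ) k (proj₁ pk)) (at-map (_+ l) ρ k pk)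

InRange-arc : ∀ σ → InRange (length σ) σ → InRange (length (arc σ)) (arc σ)
InRange-arc σ σ-range = All.zipWith (λ (1≤x , x≤) → 1≤x , x≤)
  (All.++⁺ (s≤s z≤n ∷ map-+1-positive σ) (s≤s z≤n ∷ []) , arc-bounded σ σ-range)

at-arc-last : ∀ σ → at (arc σ) (suc (suc (length σ))) ≡ 1
at-arc-last σ = trans (cong (at (map (_+ 1) σ ++ [ 1 ])) (trans (ℕ.+-comm 1 (length σ)) (cong (_+ 1) (sym (length-map (_+ 1) σ)))))
                      (at-++ʳ (map (_+ 1) σ) [ 1 ] 1 (s≤s z≤n))

at-arc-inner : ∀ σ i → Position σ i → at (arc σ) (suc i) ≡ at σ i + 1
at-arc-inner σ i (1≤i , i≤) = trans (at-suc _ _ i 1≤i)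
  (trans (at-++ˡ (map (_+ 1) σ) [ 1 ] i (subst (i ≤_) (sym (length-map (_+ 1) σ)) i≤)) (at-map (_+ 1) σ i (1≤i , i≤)))

Involutive-arc : ∀ σ → Involutive σ → InRange (length σ) σ → Involutive (arc σ)
Involutive-arc σ σ-inv σ-range (suc zero) _ = at-arc-last σ
Involutive-arc σ σ-inv σ-range (suc (suc k)) (_ , s≤s k<) with suc k ℕ.≤? length σ
... | yes k<σ = begin
  at (arc σ) (at (arc σ) (suc (suc k)))  ≡⟨ cong (at (arc σ)) (at-arc-inner σ (suc k) pk) ⟩
  at (arc σ) (at σ (suc k) + 1)          ≡⟨ cong (at (arc σ)) (ℕ.+-comm (at σ (suc k)) 1) ⟩
  at (arc σ) (suc (at σ (suc k)))        ≡⟨ at-arc-inner σ (at σ (suc k)) (All-at σ σ-range (suc k) pk) ⟩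
  at σ (at σ (suc k)) + 1                ≡⟨ cong (_+ 1) (σ-inv (suc k) pk) ⟩
  suc k + 1                              ≡⟨ ℕ.+-comm (suc k) 1 ⟩
  suc (suc k)                            ∎
  where
  open ≡-Reasoning
  pk : Position σ (suc k)
  pk = s≤s z≤n , k<σ
... | no k≮σ with refl ← ℕ.≤-antisym (ℕ.≤-pred (subst (suc k ≤_) (ℕ.suc-injective (length-arc σ)) k<))
                                     (ℕ.≤-pred (ℕ.≰⇒> k≮σ)) = cong (at (arc σ)) (at-arc-last σ)

involutive-block : ∀ L B R {l} → length L ≡ l → Involutive (L ++ B ++ R) →
                   (∀ i → Position B i → l < at B i × at B i ≤ l + length B) →
                   ∃ λ σ → B ≡ map (_+ l) σ × Involutive σ × InRange (length σ) σ
involutive-block L B R refl τ-inv B-values = σ , B≡ , σ-inv , σ-range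
  where
  l : ℕ
  l = length L
  τ σ : List ℕ
  τ = L ++ B ++ R
  σ = map (_∸ l) B
  length-σ : length σ ≡ length B
  length-σ = length-map (_∸ l) B
  at-τ : ∀ i → Position B i → at τ (l + i) ≡ at B i
  at-τ i (1≤i , i≤) = trans (at-++ʳ L (B ++ R) i 1≤i) (at-++ˡ B R i i≤)
  position-τ : ∀ i → Position B i → Position τ (l + i)
  position-τ i (1≤i , i≤) = ℕ.≤-trans 1≤i (ℕ.m≤n+m i l) ,
    subst (l + i ≤_) (sym (trans (length-++ L) (cong (l +_) (length-++ B))))
          (ℕ.+-monoʳ-≤ l (ℕ.≤-trans i≤ (ℕ.m≤m+n (length B) (length R))))
  value-position : ∀ i → Position B i → Position B (at B i ∸ l)
  value-position i pi with B-values i pi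
  ... | l< , ≤l+ = ℕ.m<n⇒0<n∸m l< , subst (at B i ∸ l ≤_) (ℕ.m+n∸m≡n l (length B)) (ℕ.∸-monoˡ-≤ l ≤l+)
  σ-position : ∀ {i} → Position σ i → Position B i
  σ-position (1≤i , i≤) = 1≤i , subst (_ ≤_) length-σ i≤
  σ-inv : Involutive σ
  σ-inv i pi = begin
    at σ (at σ i)                  ≡⟨ cong (at σ) (at-map (_∸ l) B i pi′) ⟩
    at σ (at B i ∸ l)              ≡⟨ at-map (_∸ l) B _ (value-position i pi′) ⟩
    at B (at B i ∸ l) ∸ l          ≡⟨ cong (_∸ l) (at-τ _ (value-position i pi′)) ⟨
    at τ (l + (at B i ∸ l)) ∸ l    ≡⟨ cong (λ k → at τ k ∸ l) (ℕ.m+[n∸m]≡n (ℕ.<⇒≤ (proj₁ (B-values i pi′)))) ⟩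
    at τ (at B i) ∸ l              ≡⟨ cong (λ k → at τ k ∸ l) (at-τ i pi′) ⟨
    at τ (at τ (l + i)) ∸ l        ≡⟨ cong (_∸ l) (τ-inv (l + i) (position-τ i pi′)) ⟩
    l + i ∸ l                      ≡⟨ ℕ.m+n∸m≡n l i ⟩
    i                              ∎
    where
    open ≡-Reasoning
    pi′ : Position B i
    pi′ = σ-position pi
  σ-range : InRange (length σ) σ
  σ-range = at-All σ (λ i pi → subst (λ v → 1 ≤ v × v ≤ length σ) (sym (at-map (_∸ l) B i (σ-position pi)))
                                      (subst (λ n → 1 ≤ at B i ∸ l × at B i ∸ l ≤ n) (sym length-σ)
                                             (value-position i (σ-position pi))))
  B≡ : B ≡ map (_+ l) σ
  B≡ = sym (trans (sym (map-∘ B)) (shift-back B (at-All B (λ i pi → ℕ.<⇒≤ (proj₁ (B-values i pi))))))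
    where
    shift-back : ∀ xs → All (l ≤_) xs → map (λ x → x ∸ l + l) xs ≡ xs
    shift-back []       []           = refl
    shift-back (x ∷ xs) (l≤x ∷ l≤xs) = cong₂ _∷_ (ℕ.m∸n+n≡m l≤x) (shift-back xs l≤xs)

isAvInvolution : List ℕ → Bool
isAvInvolution τ = isInvolution τ ∧ avoids p3412 τ

avInvolutions : ℕ → List (List ℕ)
avInvolutions n = filterᵇ isAvInvolution (perms n)

record AvInvolution (n : ℕ) (τ : List ℕ) : Set where
  field
    length≡    : length τ ≡ n
    inRange    : InRange n τ
    involutive : Involutive τ
    avoids3412 : ¬ Contains p3412 τ

∈-avInvolutions⁻ : ∀ n {τ} → τ ∈ avInvolutions n → AvInvolution n τ
∈-avInvolutions⁻ n {τ} τ∈ with ∈-filter⁻ (T? ∘ isAvInvolution) {xs = perms n} τ∈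
... | τ∈perms , t with T-∧⁻ (isInvolution τ) t | ∈-perms⁻ n τ∈perms
... | t-inv , t-av | τ↭ = record
  { length≡    = trans (↭-length τ↭) (length-positions n)
  ; inRange    = All.tabulate (λ x∈ → ∈-positions⁻ (∈-resp-↭ τ↭ x∈))
  ; involutive = isInvolution⇒Involutive τ t-inv
  ; avoids3412 = avoids⇒¬Contains t-av
  }

∈-avInvolutions⁺ : ∀ {n τ} → AvInvolution n τ → τ ∈ avInvolutions n
∈-avInvolutions⁺ {n} {τ} τ-av = ∈-filter⁺ (T? ∘ isAvInvolution)
  (∈-perms⁺ n (Involutive⇒↭positions n τ length≡ inRange involutive))
  (T-∧⁺ (Involutive⇒isInvolution τ involutive) (¬Contains⇒avoids avoids3412))
  where open AvInvolution τ-av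

avInvolutions-unique : ∀ n → Unique (avInvolutions n)
avInvolutions-unique n = Unique.filter⁺ (T? ∘ isAvInvolution) (perms-unique n)

module _ {n τ} (τ-av : AvInvolution n τ) where
  open AvInvolution τ-av

  inRange-length : InRange (length τ) τ
  inRange-length = subst (λ k → InRange k τ) (sym length≡) inRange

  positive : Positive τ
  positive = All.map proj₁ inRange

-- Signs

below : ℕ → List ℕ → ℕ
below x xs = foldr _+_ 0 (map (λ y → if y <ᵇ x then 1 else 0) xs)

below-++ : ∀ x xs ys → below x (xs ++ ys) ≡ below x xs + below x ys
below-++ x []       ys = refl
below-++ x (y ∷ xs) ys rewrite below-++ x xs ys = sym (ℕ.+-assoc (if y <ᵇ x then 1 else 0) (below x xs) (below x ys))

below-≥ : ∀ x ys → All (x ≤_) ys → below x ys ≡ 0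
below-≥ x []       []           = refl
below-≥ x (y ∷ ys) (x≤y ∷ x≤ys) rewrite <ᵇ-false {y} {x} x≤y = below-≥ x ys x≤ys

below-< : ∀ x ys → All (_< x) ys → below x ys ≡ length ys
below-< x []       []           = refl
below-< x (y ∷ ys) (y<x ∷ ys<x) rewrite <ᵇ-true {y} {x} y<x = cong suc (below-< x ys ys<x)

below-map : ∀ c x ys → below (x + c) (map (_+ c) ys) ≡ below x ys
below-map c x []       = refl
below-map c x (y ∷ ys) rewrite +-<ᵇ-+ c y x = cong ((if y <ᵇ x then 1 else 0) +_) (below-map c x ys)

inversions-map : ∀ c ys → inversions (map (_+ c) ys) ≡ inversions ys
inversions-map c []       = refl
inversions-map c (y ∷ ys) = cong₂ _+_ (below-map c y ys) (inversions-map c ys)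

inversions-++ : ∀ xs ys → All (λ x → All (x <_) ys) xs → inversions (xs ++ ys) ≡ inversions xs + inversions ys
inversions-++ []       ys []         = refl
inversions-++ (x ∷ xs) ys (x< ∷ xs<) rewrite below-++ x xs ys | below-≥ x ys (All.map ℕ.<⇒≤ x<) | inversions-++ xs ys xs< =
  trans (cong (_+ (inversions xs + inversions ys)) (ℕ.+-identityʳ (below x xs)))
        (sym (ℕ.+-assoc (below x xs) (inversions xs) (inversions ys)))

inversions-∷ʳ : ∀ y xs → All (y <_) xs → inversions (xs ++ [ y ]) ≡ inversions xs + length xs
inversions-∷ʳ y []       []         = refl
inversions-∷ʳ y (x ∷ xs) (y<x ∷ y<xs) rewrite below-++ x xs [ y ] | <ᵇ-true {y} {x} y<x | inversions-∷ʳ y xs y<xs =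
  solve 3 (λ b i l → (b :+ con 1) :+ (i :+ l) := (b :+ i) :+ (con 1 :+ l)) refl (below x xs) (inversions xs) (length xs)
  where open ℕ-Solver

sgn-+ : ∀ m n → sgn (m + n) ≡ sgn m *ℤ sgn n
sgn-+ zero    n = sym (ℤ.*-identityˡ (sgn n))
sgn-+ (suc m) n rewrite sgn-+ m n = ℤ.neg-distribˡ-* (sgn m) (sgn n)

sgn-+-self : ∀ n → sgn (n + n) ≡ 1ℤ
sgn-+-self zero    = refl
sgn-+-self (suc n) rewrite ℕ.+-suc n n | ℤ.neg-involutive (sgn (n + n)) = sgn-+-self n

sign-1⊞ : ∀ ρ → sign ([ 1 ] ⊞ ρ) ≡ sign ρ
sign-1⊞ ρ = cong sgn (trans (cong (_+ inversions (map (_+ 1) ρ)) (below-≥ 1 (map (_+ 1) ρ) (map-+1-positive ρ)))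
                                  (inversions-map 1 ρ))

inversions-arc : ∀ σ → InRange (length σ) σ → inversions (arc σ) ≡ suc (length σ) + (inversions σ + length σ)
inversions-arc σ σ-range = cong₂ _+_ first rest
  where
  first : below (suc (suc (length σ))) (map (_+ 1) σ ++ [ 1 ]) ≡ suc (length σ)
  first = trans (below-< _ _ (arc-tail-bounded σ σ-range)) (ℕ.suc-injective (length-arc σ))
  rest : inversions (map (_+ 1) σ ++ [ 1 ]) ≡ inversions σ + length σ
  rest = trans (inversions-∷ʳ 1 (map (_+ 1) σ) (All.map⁺ (All.map (λ (1≤x , _) → ℕ.+-monoˡ-≤ 1 1≤x) σ-range)))
               (cong₂ _+_ (inversions-map 1 σ) (length-map (_+ 1) σ))

sign-arc⊞ : ∀ σ ρ → InRange (length σ) σ → Positive ρ → sign (arc σ ⊞ ρ) ≡ - (sign σ *ℤ sign ρ)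
sign-arc⊞ σ ρ σ-range ρ-pos = begin
  sgn (inversions (arc σ ⊞ ρ))
    ≡⟨ cong sgn (inversions-++ (arc σ) _ (⊞-below (arc σ) ρ (arc-bounded σ σ-range) ρ-pos)) ⟩
  sgn (inversions (arc σ) + inversions (map (_+ length (arc σ)) ρ))
    ≡⟨ cong sgn (cong₂ _+_ (inversions-arc σ σ-range) (inversions-map (length (arc σ)) ρ)) ⟩
  sgn ((suc l + (i + l)) + r)
    ≡⟨ cong sgn (solve 3 (λ l i r → (con 1 :+ l :+ (i :+ l)) :+ r := con 1 :+ (i :+ r) :+ (l :+ l)) refl l i r) ⟩
  sgn (suc (i + r) + (l + l))
    ≡⟨ sgn-+ (suc (i + r)) (l + l) ⟩
  - sgn (i + r) *ℤ sgn (l + l)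
    ≡⟨ cong₂ _*ℤ_ (cong -_ (sgn-+ i r)) (sgn-+-self l) ⟩
  - (sgn i *ℤ sgn r) *ℤ 1ℤ
    ≡⟨ ℤ.*-identityʳ _ ⟩
  - (sgn i *ℤ sgn r) ∎
  where
  open ≡-Reasoning
  open ℕ-Solver
  l i r : ℕ
  l = length σ
  i = inversions σ
  r = inversions ρ

-- Arcs and the pattern families

Contains-⊞ˡ : ∀ {π} σ ρ → Contains π σ → Contains π (σ ⊞ ρ)
Contains-⊞ˡ σ ρ c = Contains-⊆ c (Sublist.++ʳ _ ⊆-refl)

Contains-⊞ʳ : ∀ {π} σ ρ → Contains π ρ → Contains π (σ ⊞ ρ)
Contains-⊞ʳ σ ρ c = Contains-⊆ (Contains-map⁺ (length σ) ρ c) (Sublist.++ˡ σ ⊆-refl)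

Contains-⊞⁻ : ∀ {π} σ ρ → SumIndecomposable π → All (_≤ length σ) σ → Positive ρ →
              Contains π (σ ⊞ ρ) → Contains π σ ⊎ Contains π ρ
Contains-⊞⁻ σ ρ indec σ≤ ρ-pos =
  map₂ (Contains-map⁻ (length σ) ρ) ∘′ Contains-++ σ _ indec (⊞-below σ ρ σ≤ ρ-pos)

Contains-arc : ∀ {π} σ → Contains π σ → Contains π (arc σ)
Contains-arc σ c = Contains-⊆ (Contains-map⁺ 1 σ c) (_ ∷ʳ Sublist.++ʳ [ 1 ] ⊆-refl)

Contains-1⊞⁻ : ∀ {π} ρ → SumIndecomposable π → 2 ≤ length π → Positive ρ →
               Contains π ([ 1 ] ⊞ ρ) → Contains π ρ
Contains-1⊞⁻ ρ indec 2≤π ρ-pos =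
  [ (λ c → ⊥-elim (ℕ.<⇒≱ 2≤π (Contains⇒length≤ c))) , id ]′ ∘′ Contains-⊞⁻ [ 1 ] ρ indec (s≤s z≤n ∷ []) ρ-pos

Contains-arc⊞⁻ : ∀ {π π′} σ ρ → SumIndecomposable π → InRange (length σ) σ → Positive ρ →
                 (Contains π (arc σ) → Contains π′ σ) → Contains π (arc σ ⊞ ρ) → Contains π′ σ ⊎ Contains π ρ
Contains-arc⊞⁻ σ ρ indec σ-range ρ-pos arc⁻ =
  map₁ arc⁻ ∘′ Contains-⊞⁻ (arc σ) ρ indec (arc-bounded σ σ-range) ρ-pos

avoids-1⊞ : ∀ {π} ρ → SumIndecomposable π → 2 ≤ length π → Positive ρ → avoids π ([ 1 ] ⊞ ρ) ≡ avoids π ρ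
avoids-1⊞ ρ indec 2≤π ρ-pos = avoids-cong (Contains-1⊞⁻ ρ indec 2≤π ρ-pos) (Contains-⊞ʳ [ 1 ] ρ)

avoids-arc⊞ : ∀ {π π′} σ ρ → SumIndecomposable π → InRange (length σ) σ → Positive ρ →
              (Contains π (arc σ) ⇔ Contains π′ σ) → avoids π (arc σ ⊞ ρ) ≡ avoids π′ σ ∧ avoids π ρ
avoids-arc⊞ σ ρ indec σ-range ρ-pos arc⇔ = avoids-∧
  (Contains-arc⊞⁻ σ ρ indec σ-range ρ-pos (Equivalence.to arc⇔))
  (Contains-⊞ˡ (arc σ) ρ ∘′ Equivalence.from arc⇔)
  (Contains-⊞ʳ (arc σ) ρ)

max∷-indecomposable : ∀ m π → All (_≤ m) π → SumIndecomposable (m ∷ π)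
max∷-indecomposable m π π≤m []       p₂       _    p₁≢[] _     _ = p₁≢[] refl
max∷-indecomposable m π π≤m (b ∷ p₁) []       _    _     p₂≢[] _ = p₂≢[] refl
max∷-indecomposable m π π≤m (b ∷ p₁) (z ∷ p₂) refl _     _     (b< ∷ _) =
  ℕ.<⇒≱ (All.head b<) (All.lookup π≤m (∈-++⁺ʳ p₁ (here refl)))

3412-indecomposable : SumIndecomposable p3412
3412-indecomposable []                    _ _    p₁≢[] _     _                         = p₁≢[] refl
3412-indecomposable (3 ∷ [])              _ refl _     _     ((_ ∷ s≤s () ∷ _) ∷ _)
3412-indecomposable (3 ∷ 4 ∷ [])          _ refl _     _     ((s≤s () ∷ _) ∷ _)
3412-indecomposable (3 ∷ 4 ∷ 1 ∷ [])      _ refl _     _     ((s≤s (s≤s ()) ∷ _) ∷ _)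
3412-indecomposable (3 ∷ 4 ∷ 1 ∷ 2 ∷ []) _ refl _     p₂≢[] _                         = p₂≢[] refl

decr⊖12 : ℕ → List ℕ
decr⊖12 zero    = 1 ∷ 2 ∷ []
decr⊖12 (suc k) = suc k + 2 ∷ decr⊖12 k

decr⊖231 : ℕ → List ℕ
decr⊖231 k = map (_+ 1) (decr⊖12 k) ++ [ 1 ]

decr-suc : ∀ k → decr (suc k) ≡ suc k ∷ decr k
decr-suc k = trans (cong reverse (positions-suc k)) (reverse-++ (positions k) [ suc k ])

decr⊖12≡ : ∀ k → decr k ⊖ p12 ≡ decr⊖12 k
decr⊖12≡ zero    = refl
decr⊖12≡ (suc k) rewrite decr-suc k = cong (suc k + 2 ∷_) (decr⊖12≡ k)

decr⊖231≡ : ∀ k → decr k ⊖ p231 ≡ decr⊖231 k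
decr⊖231≡ k = begin
  map (_+ 3) (decr k) ++ 2 ∷ 3 ∷ 1 ∷ []
    ≡⟨ cong (_++ 2 ∷ 3 ∷ 1 ∷ []) (map-cong (λ x → ℕ.+-assoc x 2 1) (decr k)) ⟨
  map (λ x → x + 2 + 1) (decr k) ++ 2 ∷ 3 ∷ 1 ∷ []
    ≡⟨ cong (_++ 2 ∷ 3 ∷ 1 ∷ []) (map-∘ (decr k)) ⟩
  map (_+ 1) (map (_+ 2) (decr k)) ++ 2 ∷ 3 ∷ 1 ∷ []
    ≡⟨ ++-assoc (map (_+ 1) (map (_+ 2) (decr k))) (2 ∷ 3 ∷ []) [ 1 ] ⟨
  (map (_+ 1) (map (_+ 2) (decr k)) ++ 2 ∷ 3 ∷ []) ++ [ 1 ]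
    ≡⟨ cong (_++ [ 1 ]) (map-++ (_+ 1) (map (_+ 2) (decr k)) p12) ⟨
  map (_+ 1) (decr k ⊖ p12) ++ [ 1 ]
    ≡⟨ cong (λ π → map (_+ 1) π ++ [ 1 ]) (decr⊖12≡ k) ⟩
  decr⊖231 k ∎
  where open ≡-Reasoning

decr⊖12-bounded : ∀ k → All (_≤ k + 2) (decr⊖12 k)
decr⊖12-bounded zero    = s≤s z≤n ∷ s≤s (s≤s z≤n) ∷ []
decr⊖12-bounded (suc k) = ℕ.≤-refl ∷ All.map ℕ.m≤n⇒m≤1+n (decr⊖12-bounded k)

decr⊖231-bounded : ∀ k → All (_≤ suc k + 2 + 1) (decr⊖231 k)
decr⊖231-bounded k = All.++⁺ (All.map⁺ (All.map (λ x≤ → ℕ.+-monoˡ-≤ 1 (ℕ.m≤n⇒m≤1+n x≤)) (decr⊖12-bounded k))) (s≤s z≤n ∷ [])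

-- every pattern decr⊖12 k ends with 1 2
decr⊖12-ends-above : ∀ k p q → decr⊖12 k ≡ p ++ [ q ] → ¬ All (q ≤_) p
decr⊖12-ends-above zero    p q eq with refl , refl ← ∷ʳ-injective [ 1 ] p eq = λ { (s≤s () ∷ []) }
decr⊖12-ends-above (suc zero)    []      q ()
decr⊖12-ends-above (suc (suc k)) []      q ()
decr⊖12-ends-above (suc k)       (_ ∷ p) q eq (_ ∷ q≤p) = decr⊖12-ends-above k p q (∷-injectiveʳ eq) q≤p

3412-ends-above : ∀ p q → p3412 ≡ p ++ [ q ] → ¬ All (q ≤_) p
3412-ends-above p q eq with refl , refl ← ∷ʳ-injective (3 ∷ 4 ∷ 1 ∷ []) p eq = λ { (_ ∷ _ ∷ s≤s () ∷ []) }

arc-tail-≤ : ∀ σ → InRange (length σ) σ → All (_≤ suc (suc (length σ))) (map (_+ 1) σ ++ [ 1 ])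
arc-tail-≤ σ σ-range = All.map ℕ.<⇒≤ (arc-tail-bounded σ σ-range)

Contains-arc-tail⁻ : ∀ {π} σ → (∀ p q → π ≡ p ++ [ q ] → ¬ All (q ≤_) p) →
                     Contains π (map (_+ 1) σ ++ [ 1 ]) → Contains π σ
Contains-arc-tail⁻ σ ends-above c with Contains-∷ʳ⁻ (map (_+ 1) σ) (map-+1-positive σ) c
... | inj₁ c′                     = Contains-map⁻ 1 σ c′
... | inj₂ (p , q , eq , q≤p , _) = ⊥-elim (ends-above p q eq q≤p)

Contains-∷-arc⁻ : ∀ {b π} σ → Contains (b ∷ π) (arc σ) → Contains π (map (_+ 1) σ ++ [ 1 ])
Contains-∷-arc⁻ σ c = [ Contains-tail , id ]′ (Contains-∷⁻ c)

Contains-+1∷ʳ1 : ∀ {π} xs → Contains π xs → Contains (map (_+ 1) π ++ [ 1 ]) (map (_+ 1) xs ++ [ 1 ])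
Contains-+1∷ʳ1 {π} xs (s , s⊆ , t) =
  map (_+ 1) s ++ [ 1 ] , Sublist.++⁺ (⊆-map⁺ (_+ 1) s⊆) ⊆-refl ,
  sameOrder′-++⁺ (map (_+ 1) s) [ 1 ] (map (_+ 1) π) [ 1 ] length≡
    (subst T (sym (trans (sameOrder′-mapˡ 1 s (map (_+ 1) π)) (sameOrder′-mapʳ 1 s π))) t) _
    (cross-≥⁺ (map (_+ 1) s) [ 1 ] (map (_+ 1) π) [ 1 ] (All.map (_∷ []) (map-+1-positive s))
              (All.map (_∷ []) (map-+1-positive π)) length≡ refl)
  where
  length≡ : length (map (_+ 1) s) ≡ length (map (_+ 1) π)
  length≡ = trans (length-map (_+ 1) s) (trans (sameOrder′⇒length≡ s π t) (sym (length-map (_+ 1) π)))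

arc-3412 : ∀ σ → InRange (length σ) σ → Contains p3412 (arc σ) ⇔ Contains p3412 σ
arc-3412 σ σ-range = mk⇔
  (Contains-arc-tail⁻ σ 3412-ends-above ∘′ Contains-max∷ (arc-tail-≤ σ σ-range) (s≤s (s≤s (s≤s (s≤s z≤n)))))
  (Contains-arc σ)

arc-12 : ∀ σ → InRange (length σ) σ → Contains (decr⊖12 0) (arc σ) ⇔ Contains (decr⊖12 0) σ
arc-12 σ σ-range = mk⇔
  (Contains-arc-tail⁻ σ (decr⊖12-ends-above 0) ∘′ Contains-max∷ (arc-tail-≤ σ σ-range) (s≤s (s≤s z≤n)))
  (Contains-arc σ)

arc-decr⊖12 : ∀ k σ → InRange (length σ) σ → Contains (decr⊖12 (suc k)) (arc σ) ⇔ Contains (decr⊖12 k) σ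
arc-decr⊖12 k σ σ-range = mk⇔
  (Contains-arc-tail⁻ σ (decr⊖12-ends-above k) ∘′ Contains-∷-arc⁻ σ)
  (λ c → Contains-∷⁺ (arc-tail-≤ σ σ-range) (All.map ℕ.m≤n⇒m≤1+n (decr⊖12-bounded k))
                     (Contains-⊆ (Contains-map⁺ 1 σ c) (Sublist.++ʳ [ 1 ] ⊆-refl)))

arc-decr⊖231 : ∀ k σ → InRange (length σ) σ → Contains (decr⊖231 (suc k)) (arc σ) ⇔ Contains (decr⊖12 k) σ
arc-decr⊖231 k σ σ-range = mk⇔ to
  (Contains-∷⁺ (arc-tail-≤ σ σ-range) (decr⊖231-bounded k) ∘′ Contains-+1∷ʳ1 σ)
  where
  to : Contains (decr⊖231 (suc k)) (arc σ) → Contains (decr⊖12 k) σ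
  to c with Contains-∷ʳ⁻ (map (_+ 1) σ) (map-+1-positive σ) (Contains-∷-arc⁻ σ c)
  ... | inj₁ c′ = Contains-map⁻ 1 σ (Contains-pattern-map⁻ 1 (Contains-++⁻ˡ c′))
  ... | inj₂ (p , q , eq , _ , c′) with refl , refl ← ∷ʳ-injective (map (_+ 1) (decr⊖12 k)) p eq =
    Contains-map⁻ 1 σ (Contains-pattern-map⁻ 1 c′)

Contains-12-⊞ : ∀ a σ r ρ → a ≤ length (a ∷ σ) → 1 ≤ r → Contains (decr⊖12 0) ((a ∷ σ) ⊞ (r ∷ ρ))
Contains-12-⊞ a σ r ρ a≤ 1≤r = a ∷ r + length (a ∷ σ) ∷ [] , refl ∷ Sublist.++ˡ σ (refl ∷ minimum _) , increasing
  where
  increasing : T (sameOrder′ (a ∷ r + length (a ∷ σ) ∷ []) (1 ∷ 2 ∷ []))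
  increasing rewrite <ᵇ-true (ℕ.≤-trans (s≤s a≤) (ℕ.+-monoˡ-≤ (length (a ∷ σ)) 1≤r)) = _

avoids-12-1⊞ : ∀ ρ → Positive ρ → avoids (decr⊖12 0) ([ 1 ] ⊞ ρ) ≡ null ρ
avoids-12-1⊞ []      _           = refl
avoids-12-1⊞ (r ∷ ρ) (1≤r ∷ _) = Contains⇒avoids≡false (Contains-12-⊞ 1 [] r ρ (s≤s z≤n) 1≤r)

avoids-12-arc⊞ : ∀ σ ρ → InRange (length σ) σ → Positive ρ →
                 avoids (decr⊖12 0) (arc σ ⊞ ρ) ≡ avoids (decr⊖12 0) σ ∧ null ρ
avoids-12-arc⊞ σ []      σ-range _ = trans
  (avoids-cong (Equivalence.to (arc-12 σ σ-range) ∘′ subst (Contains (decr⊖12 0)) (++-identityʳ (arc σ)))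
               (Contains-⊞ˡ (arc σ) [] ∘′ Equivalence.from (arc-12 σ σ-range)))
  (sym (∧-identityʳ _))
avoids-12-arc⊞ σ (r ∷ ρ) σ-range (1≤r ∷ _) = trans
  (Contains⇒avoids≡false (Contains-12-⊞ _ (map (_+ 1) σ ++ [ 1 ]) r ρ (ℕ.≤-reflexive (sym (length-arc σ))) 1≤r))
  (sym (∧-zeroʳ _))

decr⊖12-length : ∀ k → 2 ≤ length (decr⊖12 k)
decr⊖12-length zero    = s≤s (s≤s z≤n)
decr⊖12-length (suc k) = ℕ.m≤n⇒m≤1+n (decr⊖12-length k)

decr⊖231-length : ∀ k → 2 ≤ length (decr⊖231 (suc k))
decr⊖231-length k = s≤s (subst (1 ≤_) (sym (length-++ (map (_+ 1) (decr⊖12 k)))) (ℕ.m≤n+m 1 _))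

decr⊖12-indecomposable : ∀ k → SumIndecomposable (decr⊖12 (suc k))
decr⊖12-indecomposable k = max∷-indecomposable _ _ (All.map ℕ.m≤n⇒m≤1+n (decr⊖12-bounded k))

decr⊖231-indecomposable : ∀ k → SumIndecomposable (decr⊖231 (suc k))
decr⊖231-indecomposable k = max∷-indecomposable _ _ (decr⊖231-bounded k)

-- Decomposition of 3412-avoiding involutions

1-involutive : Involutive [ 1 ]
1-involutive (suc zero)    _            = refl
1-involutive (suc (suc i)) (_ , s≤s ())

1⊞-AvInvolution : ∀ {n ρ} → AvInvolution n ρ → AvInvolution (suc n) ([ 1 ] ⊞ ρ)
1⊞-AvInvolution {n} {ρ} ρ-av = record
  { length≡    = cong suc (trans (length-map (_+ 1) ρ) length≡)
  ; inRange    = subst (λ k → InRange (suc k) ([ 1 ] ⊞ ρ)) length≡ (InRange-⊞ [ 1 ] ρ 1-range (inRange-length ρ-av))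
  ; involutive = Involutive-⊞ [ 1 ] ρ 1-involutive 1-range involutive (inRange-length ρ-av)
  ; avoids3412 = avoids3412 ∘′ Contains-1⊞⁻ ρ 3412-indecomposable (s≤s (s≤s z≤n)) (positive ρ-av)
  }
  where
  open AvInvolution ρ-av
  1-range : InRange 1 [ 1 ]
  1-range = (s≤s z≤n , s≤s z≤n) ∷ []

arc⊞-AvInvolution : ∀ {j k σ ρ} → AvInvolution j σ → AvInvolution k ρ → AvInvolution (suc (suc j) + k) (arc σ ⊞ ρ)
arc⊞-AvInvolution {j} {k} {σ} {ρ} σ-av ρ-av = record
  { length≡    = length≡
  ; inRange    = subst (λ l → InRange l (arc σ ⊞ ρ)) (trans (sym (length-⊞ (arc σ) ρ)) length≡)
                   (InRange-⊞ (arc σ) ρ (InRange-arc σ (inRange-length σ-av)) (inRange-length ρ-av))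
  ; involutive = Involutive-⊞ (arc σ) ρ (Involutive-arc σ (AvInvolution.involutive σ-av) (inRange-length σ-av))
                   (InRange-arc σ (inRange-length σ-av)) (AvInvolution.involutive ρ-av) (inRange-length ρ-av)
  ; avoids3412 = [ AvInvolution.avoids3412 σ-av , AvInvolution.avoids3412 ρ-av ]′
                 ∘′ Contains-arc⊞⁻ σ ρ 3412-indecomposable (inRange-length σ-av) (positive ρ-av)
                                   (Equivalence.to (arc-3412 σ (inRange-length σ-av)))
  }
  where
  length≡ : length (arc σ ⊞ ρ) ≡ suc (suc j) + k
  length≡ = trans (length-⊞ (arc σ) ρ)
    (cong₂ _+_ (trans (length-arc σ) (cong (suc ∘′ suc) (AvInvolution.length≡ σ-av))) (AvInvolution.length≡ ρ-av))

-- the involutions of length n + 1 that begin with j + 2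
arcs : ℕ → ℕ → List (List ℕ)
arcs n j = cartesianProductWith (λ σ ρ → arc σ ⊞ ρ) (avInvolutions j) (avInvolutions (n ∸ 1 ∸ j))

decomposition : ℕ → List (List ℕ)
decomposition n = map ([ 1 ] ⊞_) (avInvolutions n) ++ concatMap (arcs n) (upTo n)

Contains-3412 : ∀ m A B {v p} → v ∈ A → p ∈ B → m < v → p < m → 1 < p → Contains p3412 (m ∷ A ++ 1 ∷ B)
Contains-3412 m A B {v} {p} v∈ p∈ m<v p<m 1<p =
  m ∷ v ∷ 1 ∷ p ∷ [] , refl ∷ Sublist.++⁺ (from∈ v∈) (refl ∷ from∈ p∈) , order
  where
  order : T (sameOrder′ (m ∷ v ∷ 1 ∷ p ∷ []) p3412)
  order rewrite <ᵇ-true m<v | <ᵇ-false {m} {1} (ℕ.≤-trans (ℕ.<⇒≤ 1<p) (ℕ.<⇒≤ p<m)) | <ᵇ-false {m} {p} (ℕ.<⇒≤ p<m)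
              | <ᵇ-false {v} {1} (ℕ.≤-trans (ℕ.<⇒≤ 1<p) (ℕ.<⇒≤ (ℕ.<-trans p<m m<v)))
              | <ᵇ-false {v} {p} (ℕ.<⇒≤ (ℕ.<-trans p<m m<v)) | <ᵇ-true 1<p = _

module ArcDecomposition {n} (A B : List ℕ) (τ-av : AvInvolution (suc n) (suc (suc (length A)) ∷ A ++ 1 ∷ B)) where
  open AvInvolution τ-av

  a m : ℕ
  a = length A
  m = suc (suc a)

  τ : List ℕ
  τ = m ∷ A ++ 1 ∷ B

  length-τ : length τ ≡ m + length B
  length-τ = cong suc (trans (length-++ A) (ℕ.+-suc a (length B)))

  a<n : a < n
  a<n = subst (a <_) (ℕ.suc-injective (trans (sym length-τ) length≡)) (s≤s (ℕ.m≤m+n a (length B)))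

  at-A : ∀ i → Position A i → at τ (suc i) ≡ at A i
  at-A i (1≤i , i≤) = trans (at-suc m (A ++ 1 ∷ B) i 1≤i) (at-++ˡ A (1 ∷ B) i i≤)

  at-B : ∀ i → Position B i → at τ (m + i) ≡ at B i
  at-B (suc i) _ = trans (cong (at (A ++ 1 ∷ B)) (sym (ℕ.+-suc a (suc i)))) (at-++ʳ A (1 ∷ B) (suc (suc i)) (s≤s z≤n))

  at-m : at τ m ≡ 1
  at-m = trans (cong (at (A ++ 1 ∷ B)) (ℕ.+-comm 1 a)) (at-++ʳ A (1 ∷ B) 1 (s≤s z≤n))

  A-position : ∀ {i} → Position A i → Position τ (suc i)
  A-position {i} (1≤i , i≤) =
    s≤s z≤n , subst (suc i ≤_) (sym length-τ) (ℕ.≤-trans (s≤s i≤) (ℕ.≤-trans (ℕ.n≤1+n (suc a)) (ℕ.m≤m+n m (length B))))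

  B-position : ∀ {i} → Position B i → Position τ (m + i)
  B-position {i} (1≤i , i≤) = ℕ.≤-trans 1≤i (ℕ.m≤n+m i m) , subst (m + i ≤_) (sym length-τ) (ℕ.+-monoʳ-≤ m i≤)

  above-m : ∀ {v} → m < v → v ≤ m + length B → Position B (v ∸ m) × m + (v ∸ m) ≡ v
  above-m {v} m<v v≤ = (ℕ.m<n⇒0<n∸m m<v , ℕ.+-cancelˡ-≤ m _ _ (subst (_≤ m + length B) (sym m+k≡v) v≤)) , m+k≡v
    where
    m+k≡v : m + (v ∸ m) ≡ v
    m+k≡v = ℕ.m+[n∸m]≡n (ℕ.<⇒≤ m<v)

  value-bound : ∀ i → Position τ i → 1 ≤ at τ i × at τ i ≤ m + length B
  value-bound i pi = let (1≤ , ≤n) = All-at τ (inRange-length τ-av) i pi in 1≤ , subst (at τ i ≤_) length-τ ≤n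

  A-values : ∀ i → Position A i → 1 < at A i × at A i ≤ suc a
  A-values i pi@(1≤i , i≤a) =
    A-value (at A i) (subst (λ v → 1 ≤ v × v ≤ m + length B) (at-A i pi) (value-bound (suc i) (A-position pi)))
            (trans (cong (at τ) (sym (at-A i pi))) (involutive (suc i) (A-position pi)))
            (at-∈ A i pi)
    where
    A-value : ∀ v → 1 ≤ v × v ≤ m + length B → at τ v ≡ suc i → v ∈ A → 1 < v × v ≤ suc a
    A-value v (1≤v , v≤) τv≡ v∈ with ℕ.<-cmp v m
    A-value (suc zero)    _ τv≡ _ | tri< _ _ _ = ⊥-elim (ℕ.n≮n a (subst (_≤ a) (sym (ℕ.suc-injective τv≡)) i≤a))
    A-value (suc (suc v)) _ τv≡ _ | tri< v<m _ _ = s≤s (s≤s z≤n) , ℕ.≤-pred v<m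
    ... | tri≈ _ refl _ = ⊥-elim (ℕ.<-irrefl (ℕ.suc-injective (trans (sym at-m) τv≡)) 1≤i)
    -- a value v > m would make m v 1 (i + 1) an occurrence of 3412
    ... | tri> _ _ m<v with above-m m<v v≤
    ...   | pk , m+k≡v = ⊥-elim (avoids3412 (Contains-3412 m A B v∈ i+1∈B m<v (s≤s (s≤s i≤a)) (s≤s 1≤i)))
      where
      i+1∈B : suc i ∈ B
      i+1∈B = subst (_∈ B) (trans (sym (at-B _ pk)) (trans (cong (at τ) m+k≡v) τv≡)) (at-∈ B _ pk)

  B-values : ∀ i → Position B i → m < at B i × at B i ≤ m + length B
  B-values i pi@(1≤i , _) =
    B-value (at B i) (subst (λ w → 1 ≤ w × w ≤ m + length B) (at-B i pi) (value-bound (m + i) (B-position pi)))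
            (trans (cong (at τ) (sym (at-B i pi))) (involutive (m + i) (B-position pi)))
    where
    m≢m+i : m ≢ m + i
    m≢m+i m≡m+i = ℕ.<-irrefl (ℕ.+-cancelˡ-≡ m 0 i (trans (ℕ.+-identityʳ m) m≡m+i)) 1≤i
    B-value : ∀ w → 1 ≤ w × w ≤ m + length B → at τ w ≡ m + i → m < w × w ≤ m + length B
    B-value w (1≤w , w≤) τw≡ with ℕ.<-cmp w m
    B-value (suc zero)    _ τw≡ | tri< _ _ _ = ⊥-elim (m≢m+i τw≡)
    B-value (suc (suc k)) _ τw≡ | tri< w<m _ _ =
      ⊥-elim (ℕ.<⇒≱ (s≤s (subst (_≤ suc a) (sym (at-A (suc k) pk)) (proj₂ (A-values (suc k) pk))))
                    (subst (m ≤_) (sym τw≡) (ℕ.m≤m+n m i)))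
      where
      pk : Position A (suc k)
      pk = s≤s z≤n , ℕ.≤-pred (ℕ.≤-pred w<m)
    ... | tri≈ _ refl _ with () ← trans (sym at-m) τw≡
    ... | tri> _ _ m<w = m<w , w≤

  σ-block : ∃ λ σ → A ≡ map (_+ 1) σ × Involutive σ × InRange (length σ) σ
  σ-block = involutive-block [ m ] A (1 ∷ B) refl involutive A-values

  ρ-block : ∃ λ ρ → B ≡ map (_+ m) ρ × Involutive ρ × InRange (length ρ) ρ
  ρ-block = involutive-block (m ∷ A ++ [ 1 ]) B [] length-prefix (subst Involutive τ≡prefix++B involutive) B-values
    where
    length-prefix : length (m ∷ A ++ [ 1 ]) ≡ m
    length-prefix = cong suc (trans (length-++ A) (ℕ.+-comm a 1))
    τ≡prefix++B : τ ≡ (m ∷ A ++ [ 1 ]) ++ B ++ []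
    τ≡prefix++B = cong (m ∷_) (trans (cong (λ z → A ++ 1 ∷ z) (sym (++-identityʳ B))) (sym (++-assoc A [ 1 ] (B ++ []))))

  σ ρ : List ℕ
  σ = proj₁ σ-block
  ρ = proj₁ ρ-block

  length-σ : length σ ≡ a
  length-σ = sym (trans (cong length (proj₁ (proj₂ σ-block))) (length-map (_+ 1) σ))

  length-ρ : length ρ ≡ n ∸ 1 ∸ a
  length-ρ = begin
    length ρ              ≡⟨ sym (trans (cong length (proj₁ (proj₂ ρ-block))) (length-map (_+ m) ρ)) ⟩
    length B              ≡⟨ ℕ.m+n∸m≡n a (length B) ⟨
    a + length B ∸ a      ≡⟨ cong (λ k → k ∸ 1 ∸ a) (ℕ.suc-injective (trans (sym length-τ) length≡)) ⟩
    n ∸ 1 ∸ a             ∎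
    where open ≡-Reasoning

  τ≡arc⊞ : τ ≡ arc σ ⊞ ρ
  τ≡arc⊞ = begin
    m ∷ A ++ 1 ∷ B
      ≡⟨ cong₂ (λ A′ B′ → m ∷ A′ ++ 1 ∷ B′) (proj₁ (proj₂ σ-block)) (proj₁ (proj₂ ρ-block)) ⟩
    m ∷ map (_+ 1) σ ++ 1 ∷ map (_+ m) ρ
      ≡⟨ cong (m ∷_) (++-assoc (map (_+ 1) σ) [ 1 ] (map (_+ m) ρ)) ⟨
    (m ∷ map (_+ 1) σ ++ [ 1 ]) ++ map (_+ m) ρ
      ≡⟨ cong (λ l → (suc (suc l) ∷ map (_+ 1) σ ++ [ 1 ]) ++ map (_+ suc (suc l)) ρ) length-σ ⟨
    arc σ ++ map (_+ suc (suc (length σ))) ρ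
      ≡⟨ cong (λ l → arc σ ++ map (_+ l) ρ) (length-arc σ) ⟨
    arc σ ⊞ ρ ∎
    where open ≡-Reasoning

  σ-av : AvInvolution a σ
  σ-av = record
    { length≡    = length-σ
    ; inRange    = subst (λ l → InRange l σ) length-σ (proj₂ (proj₂ (proj₂ σ-block)))
    ; involutive = proj₁ (proj₂ (proj₂ σ-block))
    ; avoids3412 = avoids3412 ∘′ subst (Contains p3412) (sym τ≡arc⊞) ∘′ Contains-⊞ˡ (arc σ) ρ ∘′ Contains-arc σ
    }

  ρ-av : AvInvolution (n ∸ 1 ∸ a) ρ
  ρ-av = record
    { length≡    = length-ρ
    ; inRange    = subst (λ l → InRange l ρ) length-ρ (proj₂ (proj₂ (proj₂ ρ-block)))
    ; involutive = proj₁ (proj₂ (proj₂ ρ-block))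
    ; avoids3412 = avoids3412 ∘′ subst (Contains p3412) (sym τ≡arc⊞) ∘′ Contains-⊞ʳ (arc σ) ρ
    }

  τ∈decomposition : τ ∈ decomposition n
  τ∈decomposition = subst (_∈ decomposition n) (sym τ≡arc⊞)
    (∈-++⁺ʳ (map ([ 1 ] ⊞_) (avInvolutions n))
      (∈-concat⁺′ (∈-cartesianProductWith⁺ (λ σ ρ → arc σ ⊞ ρ) (∈-avInvolutions⁺ σ-av) (∈-avInvolutions⁺ ρ-av))
                  (∈-map⁺ (arcs n) (∈-upTo⁺ a<n))))

1∷-decomposition : ∀ {n} rest → AvInvolution (suc n) (1 ∷ rest) → 1 ∷ rest ∈ decomposition n
1∷-decomposition {n} rest τ-av = ∈-++⁺ˡ (subst (_∈ map ([ 1 ] ⊞_) (avInvolutions n)) (cong (1 ∷_) (sym rest≡))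
                                                 (∈-map⁺ ([ 1 ] ⊞_) (∈-avInvolutions⁺ ρ-av)))
  where
  open AvInvolution τ-av
  length-rest : length rest ≡ n
  length-rest = ℕ.suc-injective length≡
  rest-values : ∀ i → Position rest i → 1 < at rest i × at rest i ≤ 1 + length rest
  rest-values (suc j) (_ , j<) with All-at (1 ∷ rest) inRange (suc (suc j)) (s≤s z≤n , s≤s j<)
                                  | involutive (suc (suc j)) (s≤s z≤n , s≤s j<)
  ... | 1≤v , v≤ | τv≡ = not-1 (at rest (suc j)) 1≤v τv≡ , subst (at rest (suc j) ≤_) (cong suc (sym length-rest)) v≤
    where
    not-1 : ∀ v → 1 ≤ v → at (1 ∷ rest) v ≡ suc (suc j) → 1 < v
    not-1 (suc zero)    _ ()
    not-1 (suc (suc v)) _ _ = s≤s (s≤s z≤n)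
  ρ-block : ∃ λ ρ → rest ≡ map (_+ 1) ρ × Involutive ρ × InRange (length ρ) ρ
  ρ-block = involutive-block [ 1 ] rest [] refl (subst Involutive (cong (1 ∷_) (sym (++-identityʳ rest))) involutive)
                             rest-values
  ρ : List ℕ
  ρ = proj₁ ρ-block
  rest≡ : rest ≡ map (_+ 1) ρ
  rest≡ = proj₁ (proj₂ ρ-block)
  length-ρ : length ρ ≡ n
  length-ρ = trans (sym (trans (cong length rest≡) (length-map (_+ 1) ρ))) length-rest
  ρ-av : AvInvolution n ρ
  ρ-av = record
    { length≡    = length-ρ
    ; inRange    = subst (λ l → InRange l ρ) length-ρ (proj₂ (proj₂ (proj₂ ρ-block)))
    ; involutive = proj₁ (proj₂ (proj₂ ρ-block))
    ; avoids3412 = avoids3412 ∘′ subst (Contains p3412) (cong (1 ∷_) (sym rest≡)) ∘′ Contains-⊞ʳ [ 1 ] ρ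
    }

arc∷-decomposition : ∀ {n} x rest → AvInvolution (suc n) (suc (suc x) ∷ rest) → suc (suc x) ∷ rest ∈ decomposition n
arc∷-decomposition {n} x rest τ-av with ∈-∃++ 1∈rest
  where
  open AvInvolution τ-av
  1∈rest : 1 ∈ rest
  1∈rest = subst (_∈ rest) (involutive 1 (s≤s z≤n , s≤s z≤n))
                 (at-∈ rest (suc x) (s≤s z≤n , ℕ.≤-pred (subst (suc (suc x) ≤_) (sym length≡) (proj₂ (All.head inRange)))))
... | A , B , refl with x≟|A|
  where
  open AvInvolution τ-av
  x≟|A| : x ≡ length A
  x≟|A| = ℕ.suc-injective (ℕ.suc-injective (trans (sym (cong (at τ) 1-position)) (involutive _ position)))
    where
    τ : List ℕ
    τ = suc (suc x) ∷ A ++ 1 ∷ B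
    1-position : at τ (suc (suc (length A))) ≡ 1
    1-position = trans (cong (at (A ++ 1 ∷ B)) (ℕ.+-comm 1 (length A))) (at-++ʳ A (1 ∷ B) 1 (s≤s z≤n))
    position : Position τ (suc (suc (length A)))
    position = s≤s z≤n , s≤s (subst (suc (length A) ≤_) (sym (length-++ A)) (ℕ.m<m+n (length A) (s≤s z≤n)))
... | refl = ArcDecomposition.τ∈decomposition A B τ-av

∈-decomposition⁺ : ∀ n {τ} → AvInvolution (suc n) τ → τ ∈ decomposition n
∈-decomposition⁺ n {[]}                 τ-av with () ← AvInvolution.length≡ τ-av
∈-decomposition⁺ n {zero ∷ rest}        τ-av with () ← proj₁ (All.head (AvInvolution.inRange τ-av))
∈-decomposition⁺ n {suc zero ∷ rest}    τ-av = 1∷-decomposition rest τ-av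
∈-decomposition⁺ n {suc (suc x) ∷ rest} τ-av = arc∷-decomposition x rest τ-av

arc-size : ∀ n j → j < n → suc (suc j) + (n ∸ 1 ∸ j) ≡ suc n
arc-size (suc n) j (s≤s j≤n) = cong (suc ∘′ suc) (ℕ.m+[n∸m]≡n j≤n)

∈-decomposition⁻ : ∀ n {τ} → τ ∈ decomposition n → τ ∈ avInvolutions (suc n)
∈-decomposition⁻ n τ∈ with ∈-++⁻ (map ([ 1 ] ⊞_) (avInvolutions n)) τ∈
... | inj₁ τ∈₁ with ∈-map⁻ ([ 1 ] ⊞_) τ∈₁
...   | ρ , ρ∈ , refl = ∈-avInvolutions⁺ (1⊞-AvInvolution (∈-avInvolutions⁻ n ρ∈))
∈-decomposition⁻ n τ∈ | inj₂ τ∈₂ with ∈-concat⁻′ (map (arcs n) (upTo n)) τ∈₂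
... | _ , τ∈arcs , arcs∈ with ∈-map⁻ (arcs n) arcs∈
... | j , j∈ , refl with ∈-cartesianProductWith⁻ (λ σ ρ → arc σ ⊞ ρ) (avInvolutions j) (avInvolutions (n ∸ 1 ∸ j)) τ∈arcs
... | σ , ρ , σ∈ , ρ∈ , refl = ∈-avInvolutions⁺ (subst (λ l → AvInvolution l (arc σ ⊞ ρ)) (arc-size n j (∈-upTo⁻ j∈))
                                 (arc⊞-AvInvolution (∈-avInvolutions⁻ j σ∈) (∈-avInvolutions⁻ (n ∸ 1 ∸ j) ρ∈)))

map-+-injective : ∀ c {xs ys} → map (_+ c) xs ≡ map (_+ c) ys → xs ≡ ys
map-+-injective c {[]}     {[]}     _  = refl
map-+-injective c {x ∷ xs} {y ∷ ys} eq =
  cong₂ _∷_ (ℕ.+-cancelʳ-≡ c x y (∷-injectiveˡ eq)) (map-+-injective c (∷-injectiveʳ eq))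

arc⊞-injective : ∀ {σ σ′ ρ ρ′} → arc σ ⊞ ρ ≡ arc σ′ ⊞ ρ′ → σ ≡ σ′ × ρ ≡ ρ′
arc⊞-injective {σ} {σ′} {ρ} {ρ′} eq with ∷-injective eq
... | head≡ , tail≡ with ℕ.suc-injective (ℕ.suc-injective head≡)
... | |σ|≡ with ++-cancel (map (_+ 1) σ ++ [ 1 ]) (map (_+ 1) σ′ ++ [ 1 ]) inner-length tail≡
  where
  inner-length : length (map (_+ 1) σ ++ [ 1 ]) ≡ length (map (_+ 1) σ′ ++ [ 1 ])
  inner-length = ℕ.suc-injective (trans (length-arc σ) (trans (cong (suc ∘′ suc) |σ|≡) (sym (length-arc σ′))))
  ++-cancel : ∀ (p q : List ℕ) {r s} → length p ≡ length q → p ++ r ≡ q ++ s → p ≡ q × r ≡ s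
  ++-cancel []      []      _ e = refl , e
  ++-cancel (x ∷ p) (y ∷ q) l e with refl , e′ ← ∷-injective e
                               with refl , e″ ← ++-cancel p q (ℕ.suc-injective l) e′ = refl , e″
... | inner≡ , shifted≡ =
  map-+-injective 1 (∷ʳ-injectiveˡ (map (_+ 1) σ) (map (_+ 1) σ′) inner≡) ,
  map-+-injective (length (arc σ)) (trans shifted≡ (cong (λ l → map (_+ l) ρ′)
    (trans (length-arc σ′) (trans (cong (suc ∘′ suc) (sym |σ|≡)) (sym (length-arc σ))))))

arcs-head : ∀ {n j τ} → τ ∈ arcs n j → head τ ≡ just (suc (suc j))
arcs-head {n} {j} τ∈ with ∈-cartesianProductWith⁻ (λ σ ρ → arc σ ⊞ ρ) (avInvolutions j) (avInvolutions (n ∸ 1 ∸ j)) τ∈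
... | σ , ρ , σ∈ , _ , refl = cong (just ∘′ suc ∘′ suc) (AvInvolution.length≡ (∈-avInvolutions⁻ j σ∈))

decomposition-unique : ∀ n → Unique (decomposition n)
decomposition-unique n = Unique.++⁺
  (Unique.map⁺ (map-+-injective 1 ∘′ ∷-injectiveʳ) (avInvolutions-unique n))
  (concatMap-unique (arcs n) (λ τ → fromMaybe 0 (head τ) ∸ 2) (Unique.upTo⁺ n)
    (λ {j} _ → Unique.cartesianProductWith⁺ (λ σ ρ → arc σ ⊞ ρ) arc⊞-injective
                 (avInvolutions-unique j) (avInvolutions-unique (n ∸ 1 ∸ j)))
    (λ {j} _ τ∈ → cong (λ h → fromMaybe 0 h ∸ 2) (arcs-head {n} {j} τ∈)))
  disjoint
  where
  disjoint : ∀ {τ} → τ ∈ map ([ 1 ] ⊞_) (avInvolutions n) × τ ∈ concatMap (arcs n) (upTo n) → ⊥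
  disjoint (τ∈₁ , τ∈₂) with ∈-map⁻ ([ 1 ] ⊞_) τ∈₁ | ∈-concat⁻′ (map (arcs n) (upTo n)) τ∈₂
  ... | ρ , _ , refl | _ , τ∈arcs , arcs∈ with ∈-map⁻ (arcs n) arcs∈
  ... | j , _ , refl with () ← arcs-head {n} {j} τ∈arcs

avInvolutions-suc↭ : ∀ n → avInvolutions (suc n) ↭ decomposition n
avInvolutions-suc↭ n = ↭-unique (avInvolutions-unique (suc n)) (decomposition-unique n)
  (∈-decomposition⁺ n ∘′ ∈-avInvolutions⁻ (suc n)) (∈-decomposition⁻ n)

-- Signed sums

weight : (List ℕ → Bool) → List ℕ → ℤ
weight Q τ = if Q τ then sign τ else 0ℤ

signedSum : (List ℕ → Bool) → Series
signedSum Q n = sumℤ (map (weight Q) (avInvolutions n))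

F⁻≗signedSum : ∀ σ → F⁻ σ ≗ₛ signedSum (avoids σ)
F⁻≗signedSum σ n = trans
  (cong sumℤ (map-cong (λ τ → cong (λ b → if b then sign τ else 0ℤ)
                                    (sym (∧-assoc (isInvolution τ) (avoids p3412 τ) (avoids σ τ)))) (perms n)))
  (sumℤ-filterᵇ isAvInvolution (avoids σ) sign (perms n))

weight-arc⊞ : ∀ (Q Q′ Q₂ : List ℕ → Bool) σ ρ → Q (arc σ ⊞ ρ) ≡ Q′ σ ∧ Q₂ ρ →
              sign (arc σ ⊞ ρ) ≡ - (sign σ *ℤ sign ρ) → weight Q (arc σ ⊞ ρ) ≡ - (weight Q′ σ *ℤ weight Q₂ ρ)
weight-arc⊞ Q Q′ Q₂ σ ρ Q≡ sign≡ rewrite Q≡ with Q′ σ | Q₂ ρ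
... | true  | true  = sign≡
... | true  | false = cong -_ (sym (ℤ.*-zeroʳ (sign σ)))
... | false | _     = cong -_ (sym (ℤ.*-zeroˡ (weight Q₂ ρ)))

shifted-convolution : ∀ a b n → sumℤ (map (λ j → a j *ℤ b (n ∸ 1 ∸ j)) (upTo n)) ≡ (xpow 1 ⊛ (a ⊛ b)) n
shifted-convolution a b zero    = sym (xpow-⊛-0 0 (a ⊛ b))
shifted-convolution a b (suc n) = sym (x⊛-suc (a ⊛ b) n)

sum-weight-1⊞ : ∀ (Q Q₁ : List ℕ → Bool) → (∀ ρ → Positive ρ → Q ([ 1 ] ⊞ ρ) ≡ Q₁ ρ) →
                ∀ n → sumℤ (map (weight Q) (map ([ 1 ] ⊞_) (avInvolutions n))) ≡ signedSum Q₁ n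
sum-weight-1⊞ Q Q₁ Q-1⊞ n =
  trans (cong sumℤ (sym (map-∘ (avInvolutions n)))) (cong sumℤ (map-cong-local (All.tabulate term)))
  where
  term : ∀ {ρ} → ρ ∈ avInvolutions n → weight Q ([ 1 ] ⊞ ρ) ≡ weight Q₁ ρ
  term {ρ} ρ∈ rewrite Q-1⊞ ρ (positive (∈-avInvolutions⁻ n ρ∈)) | sign-1⊞ ρ = refl

sum-weight-arcs : ∀ (Q Q′ Q₂ : List ℕ → Bool) →
                  (∀ σ ρ → InRange (length σ) σ → Positive ρ → Q (arc σ ⊞ ρ) ≡ Q′ σ ∧ Q₂ ρ) →
                  ∀ n j → sumℤ (map (weight Q) (arcs n j)) ≡ - (signedSum Q′ j *ℤ signedSum Q₂ (n ∸ 1 ∸ j))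
sum-weight-arcs Q Q′ Q₂ Q-arc⊞ n j = begin
  sumℤ (map (weight Q) (arcs n j))
    ≡⟨ sumℤ-cartesianProductWith (weight Q) (λ σ ρ → arc σ ⊞ ρ) (avInvolutions j) (avInvolutions k) ⟩
  sumℤ (map (λ σ → sumℤ (map (λ ρ → weight Q (arc σ ⊞ ρ)) (avInvolutions k))) (avInvolutions j))
    ≡⟨ cong sumℤ (map-cong-local (All.tabulate inner-sum)) ⟩
  sumℤ (map (λ σ → - (weight Q′ σ *ℤ signedSum Q₂ k)) (avInvolutions j))
    ≡⟨ trans (sumℤ-map-neg _ (avInvolutions j)) (cong -_ (sumℤ-map-*ʳ (signedSum Q₂ k) (weight Q′) (avInvolutions j))) ⟩
  - (signedSum Q′ j *ℤ signedSum Q₂ k) ∎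
  where
  open ≡-Reasoning
  k : ℕ
  k = n ∸ 1 ∸ j
  term : ∀ {σ ρ} → σ ∈ avInvolutions j → ρ ∈ avInvolutions k → weight Q (arc σ ⊞ ρ) ≡ - (weight Q′ σ *ℤ weight Q₂ ρ)
  term {σ} {ρ} σ∈ ρ∈ = weight-arc⊞ Q Q′ Q₂ σ ρ (Q-arc⊞ σ ρ σ-range ρ-pos) (sign-arc⊞ σ ρ σ-range ρ-pos)
    where
    σ-range : InRange (length σ) σ
    σ-range = inRange-length (∈-avInvolutions⁻ j σ∈)
    ρ-pos : Positive ρ
    ρ-pos = positive (∈-avInvolutions⁻ k ρ∈)
  inner-sum : ∀ {σ} → σ ∈ avInvolutions j →
              sumℤ (map (λ ρ → weight Q (arc σ ⊞ ρ)) (avInvolutions k)) ≡ - (weight Q′ σ *ℤ signedSum Q₂ k)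
  inner-sum {σ} σ∈ = trans (cong sumℤ (map-cong-local (All.tabulate (term σ∈))))
    (trans (sumℤ-map-neg _ (avInvolutions k)) (cong -_ (sumℤ-map-*ˡ (weight Q′ σ) (weight Q₂) (avInvolutions k))))

signedSum-suc : ∀ (Q Q₁ Q′ Q₂ : List ℕ → Bool) →
  (∀ ρ → Positive ρ → Q ([ 1 ] ⊞ ρ) ≡ Q₁ ρ) →
  (∀ σ ρ → InRange (length σ) σ → Positive ρ → Q (arc σ ⊞ ρ) ≡ Q′ σ ∧ Q₂ ρ) →
  ∀ n → signedSum Q (suc n) ≡ signedSum Q₁ n +ℤ - (xpow 1 ⊛ (signedSum Q′ ⊛ signedSum Q₂)) n
signedSum-suc Q Q₁ Q′ Q₂ Q-1⊞ Q-arc⊞ n = begin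
  sumℤ (map (weight Q) (avInvolutions (suc n)))
    ≡⟨ sumℤ-↭ (↭-map⁺ (weight Q) (avInvolutions-suc↭ n)) ⟩
  sumℤ (map (weight Q) (map ([ 1 ] ⊞_) (avInvolutions n) ++ concatMap (arcs n) (upTo n)))
    ≡⟨ trans (cong sumℤ (map-++ (weight Q) (map ([ 1 ] ⊞_) (avInvolutions n)) _))
             (sumℤ-++ (map (weight Q) (map ([ 1 ] ⊞_) (avInvolutions n))) _) ⟩
  sumℤ (map (weight Q) (map ([ 1 ] ⊞_) (avInvolutions n))) +ℤ sumℤ (map (weight Q) (concatMap (arcs n) (upTo n)))
    ≡⟨ cong₂ _+ℤ_ (sum-weight-1⊞ Q Q₁ Q-1⊞ n)
                  (trans (sumℤ-concatMap (weight Q) (arcs n) (upTo n))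
                         (cong sumℤ (map-cong (sum-weight-arcs Q Q′ Q₂ Q-arc⊞ n) (upTo n)))) ⟩
  signedSum Q₁ n +ℤ sumℤ (map (λ j → - (signedSum Q′ j *ℤ signedSum Q₂ (n ∸ 1 ∸ j))) (upTo n))
    ≡⟨ cong (signedSum Q₁ n +ℤ_)
            (trans (sumℤ-map-neg _ (upTo n)) (cong -_ (shifted-convolution (signedSum Q′) (signedSum Q₂) n))) ⟩
  signedSum Q₁ n +ℤ - (xpow 1 ⊛ (signedSum Q′ ⊛ signedSum Q₂)) n ∎
  where open ≡-Reasoning

P Ψ : ℕ → Series
P k = signedSum (avoids (decr⊖12 k))
Ψ k = signedSum (avoids (decr⊖231 (suc k)))

signedSum-null : signedSum null ≗ₛ cst 1ℤ
signedSum-null zero    = refl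
signedSum-null (suc n) =
  trans (cong sumℤ (map-cong-local (All.tabulate λ {τ} τ∈ → nonempty {τ} (AvInvolution.length≡ (∈-avInvolutions⁻ (suc n) τ∈)))))
        (sumℤ-map-0 (avInvolutions (suc n)))
  where
  nonempty : ∀ {τ} → length τ ≡ suc n → weight null τ ≡ 0ℤ
  nonempty {_ ∷ _} _ = refl

P₀-recurrence : ∀ n → P 0 (suc n) ≡ cst 1ℤ n +ℤ - (xpow 1 ⊛ (P 0 ⊛ cst 1ℤ)) n
P₀-recurrence n = trans
  (signedSum-suc (avoids (decr⊖12 0)) null (avoids (decr⊖12 0)) null avoids-12-1⊞ avoids-12-arc⊞ n)
  (cong₂ (λ a b → a +ℤ - b) (signedSum-null n)
         (⊛-cong {xpow 1} (λ _ → refl) (⊛-cong {P 0} (λ _ → refl) signedSum-null) n))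

P-recurrence : ∀ k n → P (suc k) (suc n) ≡ P (suc k) n +ℤ - (xpow 1 ⊛ (P k ⊛ P (suc k))) n
P-recurrence k = signedSum-suc π π (avoids (decr⊖12 k)) π
  (λ ρ → avoids-1⊞ ρ (decr⊖12-indecomposable k) (decr⊖12-length (suc k)))
  (λ σ ρ σ-range ρ-pos → avoids-arc⊞ σ ρ (decr⊖12-indecomposable k) σ-range ρ-pos (arc-decr⊖12 k σ σ-range))
  where
  π : List ℕ → Bool
  π = avoids (decr⊖12 (suc k))

Ψ-recurrence : ∀ k n → Ψ k (suc n) ≡ Ψ k n +ℤ - (xpow 1 ⊛ (P k ⊛ Ψ k)) n
Ψ-recurrence k = signedSum-suc π π (avoids (decr⊖12 k)) π
  (λ ρ → avoids-1⊞ ρ (decr⊖231-indecomposable k) (decr⊖231-length k))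
  (λ σ ρ σ-range ρ-pos → avoids-arc⊞ σ ρ (decr⊖231-indecomposable k) σ-range ρ-pos (arc-decr⊖231 k σ σ-range))
  where
  π : List ℕ → Bool
  π = avoids (decr⊖231 (suc k))

-- The continued fraction

module _ {c ℓ} (M : CommutativeMonoid c ℓ) where
  open CommutativeMonoid M
  open SetoidReasoning setoid

  inverse-unique : ∀ {a b m} → a ∙ m ≈ ε → b ∙ m ≈ ε → a ≈ b
  inverse-unique {a} {b} {m} a∙m≈ε b∙m≈ε = begin
    a           ≈⟨ identityʳ a ⟨
    a ∙ ε       ≈⟨ ∙-congˡ b∙m≈ε ⟨
    a ∙ (b ∙ m) ≈⟨ ∙-congˡ (comm b m) ⟩
    a ∙ (m ∙ b) ≈⟨ assoc a m b ⟨
    (a ∙ m) ∙ b ≈⟨ ∙-congʳ a∙m≈ε ⟩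
    ε ∙ b       ≈⟨ identityˡ b ⟩
    b           ∎

inverse-from-recurrence : ∀ a b → a 0 ≡ 1ℤ → (∀ n → a (suc n) ≡ a n +ℤ - (xpow 1 ⊛ (b ⊛ a)) n) →
                          a ⊛ (1-x ⊕ xpow 2 ⊛ b) ≗ₛ cst 1ℤ
inverse-from-recurrence a b a₀ a-suc n = begin
  (a ⊛ (1-x ⊕ xpow 2 ⊛ b)) n                            ≡⟨ ⊛-comm a (1-x ⊕ xpow 2 ⊛ b) n ⟩
  ((1-x ⊕ xpow 2 ⊛ b) ⊛ a) n                            ≡⟨ ⊛-distribʳ a 1-x (xpow 2 ⊛ b) n ⟩
  (1-x ⊛ a) n +ℤ ((xpow 2 ⊛ b) ⊛ a) n                   ≡⟨ cong₂ _+ℤ_ (1-x⊛-coeff a n) (⊛-assoc (xpow 2) b a n) ⟩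
  a n +ℤ - (xpow 1 ⊛ a) n +ℤ (xpow 2 ⊛ (b ⊛ a)) n       ≡⟨ coefficient n ⟩
  cst 1ℤ n                                              ∎
  where
  open ≡-Reasoning
  open ℤ-Solver
  coefficient : ∀ n → a n +ℤ - (xpow 1 ⊛ a) n +ℤ (xpow 2 ⊛ (b ⊛ a)) n ≡ cst 1ℤ n
  coefficient zero    rewrite xpow-⊛-0 0 a | xpow-⊛-0 1 (b ⊛ a) | a₀ = refl
  coefficient (suc n) rewrite x⊛-suc a n | xpow-⊛-suc 1 (b ⊛ a) n | a-suc n =
    solve 2 (λ p q → p :+ :- q :+ :- p :+ q := con 0ℤ) refl (a n) ((xpow 1 ⊛ (b ⊛ a)) n)

ratio-from-recurrence : ∀ a → a 0 ≡ 1ℤ → (∀ n → a (suc n) ≡ cst 1ℤ n +ℤ - (xpow 1 ⊛ (a ⊛ cst 1ℤ)) n) →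
                     a ⊛ 1+x² ≗ₛ 1+x
ratio-from-recurrence a a₀ a-suc n = begin
  (a ⊛ 1+x²) n                        ≡⟨ ⊛-comm a 1+x² n ⟩
  (1+x² ⊛ a) n                        ≡⟨ ⊛-distribʳ a (cst 1ℤ) (xpow 2) n ⟩
  (cst 1ℤ ⊛ a) n +ℤ (xpow 2 ⊛ a) n    ≡⟨ cong (_+ℤ (xpow 2 ⊛ a) n) (⊛-identityˡ a n) ⟩
  a n +ℤ (xpow 2 ⊛ a) n               ≡⟨ coefficient n ⟩
  1+x n                               ∎
  where
  open ≡-Reasoning
  coefficient : ∀ n → a n +ℤ (xpow 2 ⊛ a) n ≡ 1+x n
  coefficient zero          rewrite xpow-⊛-0 1 a | a₀ = refl
  coefficient (suc zero)    rewrite xpow-⊛-suc 1 a 0 | xpow-⊛-0 0 a | a-suc 0 | xpow-⊛-0 0 (a ⊛ cst 1ℤ) = refl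
  coefficient (suc (suc n)) rewrite xpow-⊛-suc 1 a (suc n) | x⊛-suc a n | a-suc (suc n) | x⊛-suc (a ⊛ cst 1ℤ) n
                                  | ⊛-comm a (cst 1ℤ) n | ⊛-identityˡ a n | ℤ.+-identityˡ (- a n) = ℤ.+-inverseˡ (a n)

module SeriesSolver = NaturalCoefficientsSolver series-commutativeSemiring
open CommutativeSemiring series-commutativeSemiring public
  using (*-commutativeMonoid; *-congˡ; *-congʳ; +-congˡ; *-identityˡ)
  renaming (refl to ≗ₛ-refl; sym to ≗ₛ-sym; trans to ≗ₛ-trans; setoid to series-setoid)

-- numerators k = Num k for k ≥ 1; at k = 0 the value 1 + x, rather than Num 0 = 0,
-- keeps numerators-rec valid.
numerators : ℕ → Series
numerators zero    = 1+x
numerators (suc k) = Num (suc k)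

Num1≗1+x² : Num 1 ≗ₛ 1+x²
Num1≗1+x² = solve 2 (λ a b → a :* con 1 :+ b :* con 0 := a) ≗ₛ-refl 1+x² (xpow 2 ⊛ 1+x)
  where open SeriesSolver

numerators-rec : ∀ k → numerators (suc (suc k)) ≗ₛ 1-x ⊛ numerators (suc k) ⊕ xpow 2 ⊛ numerators k
numerators-rec zero    = solve 4 (λ a l y e → a :* (l :* con 1 :+ y :* con 0) :+ y :* e :* con 1
                                             := l :* (a :* con 1 :+ y :* e :* con 0) :+ y :* e)
                                 ≗ₛ-refl 1+x² 1-x (xpow 2) 1+x
  where open SeriesSolver
numerators-rec (suc k) = solve 7 (λ a b l y q₂ q₁ q₀ → a :* (l :* q₂ :+ y :* q₁) :+ b :* (l :* q₁ :+ y :* q₀)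
                                            := l :* (a :* q₂ :+ b :* q₁) :+ y :* (a :* q₁ :+ b :* q₀))
                                 ≗ₛ-refl 1+x² (xpow 2 ⊛ 1+x) 1-x (xpow 2) (Q (suc (suc k))) (Q (suc k)) (Q k)
  where open SeriesSolver

continued-fraction : (S : ℕ → Series) → S 0 ⊛ 1+x² ≗ₛ 1+x →
                     (∀ k → S (suc k) ⊛ (1-x ⊕ xpow 2 ⊛ S k) ≗ₛ cst 1ℤ) →
                     ∀ k → S k ⊛ numerators (suc k) ≗ₛ numerators k
continued-fraction S S₀ S-suc zero    = ≗ₛ-trans (*-congˡ {S 0} Num1≗1+x²) S₀
continued-fraction S S₀ S-suc (suc k) = begin
  S′ ⊛ numerators (suc (suc k))                ≈⟨ *-congˡ {S′} (numerators-rec k) ⟩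
  S′ ⊛ (1-x ⊛ d ⊕ xpow 2 ⊛ numerators k)       ≈⟨ *-congˡ {S′} (+-congˡ {1-x ⊛ d} (*-congˡ {xpow 2}
                                                     (≗ₛ-sym (continued-fraction S S₀ S-suc k)))) ⟩
  S′ ⊛ (1-x ⊛ d ⊕ xpow 2 ⊛ (S k ⊛ d))          ≈⟨ solve 5 (λ p l y q d → p :* (l :* d :+ y :* (q :* d)) := p :* (l :+ y :* q) :* d)
                                                          ≗ₛ-refl S′ 1-x (xpow 2) (S k) d ⟩
  S′ ⊛ (1-x ⊕ xpow 2 ⊛ S k) ⊛ d                ≈⟨ *-congʳ {d} (S-suc k) ⟩
  cst 1ℤ ⊛ d                                   ≈⟨ *-identityˡ d ⟩
  d                                            ∎
  where
  open SeriesSolver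
  open SetoidReasoning series-setoid
  S′ d : Series
  S′ = S (suc k)
  d  = numerators (suc k)

P₀⊛1+x² : P 0 ⊛ 1+x² ≗ₛ 1+x
P₀⊛1+x² = ratio-from-recurrence (P 0) refl P₀-recurrence

P-inverse : ∀ k → P (suc k) ⊛ (1-x ⊕ xpow 2 ⊛ P k) ≗ₛ cst 1ℤ
P-inverse k = inverse-from-recurrence (P (suc k)) (P k) refl (P-recurrence k)

Ψ-inverse : ∀ k → Ψ k ⊛ (1-x ⊕ xpow 2 ⊛ P k) ≗ₛ cst 1ℤ
Ψ-inverse k = inverse-from-recurrence (Ψ k) (P k) refl (Ψ-recurrence k)

mainTheorem6 : (k : ℕ) → 1 ≤ k →
    (F⁻ (decr k ⊖ p231) ≗ₛ F⁻ (decr k ⊖ p12)) ×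
    ((F⁻ (decr k ⊖ p12) ⊛ Den k) ≗ₛ Num k)
mainTheorem6 (suc k) _ = F⁻-231≗F⁻-12 , F⁻-12⊛Den≗Num
  where
  F⁻-12≗P : F⁻ (decr (suc k) ⊖ p12) ≗ₛ P (suc k)
  F⁻-12≗P n = trans (F⁻≗signedSum (decr (suc k) ⊖ p12) n)
                    (cong (λ π → signedSum (avoids π) n) (decr⊖12≡ (suc k)))
  F⁻-231≗Ψ : F⁻ (decr (suc k) ⊖ p231) ≗ₛ Ψ k
  F⁻-231≗Ψ n = trans (F⁻≗signedSum (decr (suc k) ⊖ p231) n)
                     (cong (λ π → signedSum (avoids π) n) (decr⊖231≡ (suc k)))
  Ψ≗P : Ψ k ≗ₛ P (suc k)
  Ψ≗P = inverse-unique *-commutativeMonoid {Ψ k} {P (suc k)} {1-x ⊕ xpow 2 ⊛ P k} (Ψ-inverse k) (P-inverse k)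
  F⁻-231≗F⁻-12 : F⁻ (decr (suc k) ⊖ p231) ≗ₛ F⁻ (decr (suc k) ⊖ p12)
  F⁻-231≗F⁻-12 n = trans (F⁻-231≗Ψ n) (trans (Ψ≗P n) (sym (F⁻-12≗P n)))
  F⁻-12⊛Den≗Num : F⁻ (decr (suc k) ⊖ p12) ⊛ Den (suc k) ≗ₛ Num (suc k)
  F⁻-12⊛Den≗Num n = trans (⊛-cong {b = Den (suc k)} F⁻-12≗P (λ _ → refl) n)
                          (continued-fraction P P₀⊛1+x² P-inverse (suc k) n)
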